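{- For every integer $k\ge0$, let $P_k\in\mathbf{F}_2[x]$ be the polynomial with $T_3|\Delta^k=P_k(\Delta)$. Then $h(P_k)\le h(k)-1$.
   Context: $\Delta=\sum_{m\ge0}q^{(2m+1)^2}\in\mathbf{F}_2[[q]]$; $T_3$ is the Hecke operator sending $\sum c(n)q^n$ to $\sum\gamma(n)q^n$ with $\gamma(n)=c(3n)$ if $3\nmid n$ and $c(3n)+c(n/3)$ if $3\mid n$; it maps $\mathbf{F}_2[\Delta]$ into itself, and the exponents of $P_k$ are all congruent to $3k$ mod 8, so $P_k$ is zero or has all exponents of the parity of $k$. For an integer $k\ge0$ with binary expansion $k=\sum\beta_i2^i$: $n_3(k)=\sum_{i\text{ odd}}\beta_i2^{(i-1)/2}$, $n_5(k)=\sum_{i\ge2\text{ even}}\beta_i2^{(i-2)/2}$, $h(k)=n_3(k)+n_5(k)$. For a nonzero polynomial $P\in\mathbf{F}_2[x]$ all of whose exponents have the same parity, $h(P)$ is the maximum of $h(d)$ over the exponents $d$ of $P$; $h(0)=-\infty$. -}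

module Defs where

open import Data.Bool using (Bool; true; false; _∧_; _xor_; if_then_else_)
open import Data.Nat using (ℕ; zero; suc; _+_; _*_; _∸_; _^_; _≡ᵇ_)
open import Data.Nat.DivMod using (_/_; _%_)
open import Data.List using (List; []; _∷_; map; foldr; upTo)
open import Data.Bool.ListAction using (any)
open import Data.Nat.ListAction using (sum)

-- Formal power series over F₂ = Bool (true = 1, xor = +, ∧ = ·),
-- given by their coefficient function n ↦ c(n).
Series : Set
Series = ℕ → Bool

xsum : List Bool → Bool
xsum = foldr _xor_ false

zeroS : Series
zeroS _ = false

oneS : Series
oneS zero    = true
oneS (suc _) = false

addS : Series → Series → Series
addS f g n = f n xor g n

mulS : Series → Series → Series
mulS f g n = xsum (map (λ i → f i ∧ g (n ∸ i)) (upTo (suc n)))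

powS : Series → ℕ → Series
powS f zero    = oneS
powS f (suc k) = mulS f (powS f k)

-- Δ = Σ_{m≥0} q^{(2m+1)^2}: coefficient of q^n is 1 iff n = (2m+1)^2 for some m
-- (any such m satisfies m ≤ n, so searching m < n+1 is exhaustive).
Δ : Series
Δ n = any (λ m → ((2 * m + 1) * (2 * m + 1)) ≡ᵇ n) (upTo (suc n))

T₃ : Series → Series
T₃ c n = if (n % 3) ≡ᵇ 0 then (c (3 * n) xor c (n / 3)) else c (3 * n)

-- Polynomials in F₂[x] as coefficient lists (index i = coefficient of x^i).
Poly : Set
Poly = List Bool

coeff : Poly → ℕ → Bool
coeff []       _       = false
coeff (b ∷ _)  zero    = b
coeff (_ ∷ bs) (suc i) = coeff bs i

evalAtΔ : Poly → Series
evalAtΔ []       = zeroS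
evalAtΔ (b ∷ bs) = addS (if b then oneS else zeroS) (mulS Δ (evalAtΔ bs))

bit : ℕ → ℕ → ℕ
bit zero    k = k % 2
bit (suc i) k = bit i (k / 2)

-- n₃(k) = Σ_{i odd} β_i 2^{(i-1)/2} = Σ_j β_{2j+1} 2^j
-- n₅(k) = Σ_{i ≥ 2 even} β_i 2^{(i-2)/2} = Σ_j β_{2j+2} 2^j
-- (bits β_i with i > k vanish since 2^i > k, so j ≤ k suffices)
n₃ : ℕ → ℕ
n₃ k = sum (map (λ j → bit (2 * j + 1) k * 2 ^ j) (upTo (suc k)))

n₅ : ℕ → ℕ
n₅ k = sum (map (λ j → bit (2 * j + 2) k * 2 ^ j) (upTo (suc k)))

h : ℕ → ℕ
h k = n₃ k + n₅ k

-- Over F₂ we have T₃ = U₃ + V₃ and the modular equation Δ(q)Δ(q³) = Δ(q⁴) + Δ(q¹²): the coefficient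
-- of qⁿ on the left is the number of odd solutions of n = a² + 3b² mod 2, and an involution coming
-- from the units of ℤ[(1 + √−3)/2] pairs them off except for a = b and a = 3b. It gives the recurrence
-- T₃(Δᵏ⁺⁴) = Δ T₃(Δᵏ⁺¹) + Δ⁴ T₃(Δᵏ), which with T₃(1) = T₃(Δ) = T₃(Δ²) = 0 and T₃(Δ³) = Δ shows
-- that P_k has exponents d = 1 + a + 4b only when k = 3 + 3a + 4b, with coefficient (a+b choose a)
-- mod 2. By Lucas' theorem this is 1 only if a and b have no binary digit in common, and then a
-- base-4 digit-by-digit comparison of d and k, whose carries stay small, gives h(d) + 1 ≤ h(k).

module Submission where

open import Defs
open import Algebra.Bundles using (CommutativeRing)
open import Data.Bool using (Bool; true; false; _∧_; _xor_; not; if_then_else_)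
open import Data.Bool.Properties
  using (xor-assoc; xor-comm; xor-identityʳ; xor-same; xor-∧-commutativeRing;
         ∧-distribˡ-xor; ∧-comm; ∧-zeroʳ; ∧-assoc; ∧-idem; ∧-identityʳ; ∨-zeroʳ)
open import Algebra.Properties.CommutativeSemigroup
  (CommutativeRing.+-commutativeSemigroup xor-∧-commutativeRing) using (interchange)
open import Data.Bool.ListAction using (any)
open import Data.Nat
  using (ℕ; zero; suc; _+_; _*_; _∸_; _^_; ⌊_/2⌋; ∣_-_∣; _≤_; _<_; z≤n; s≤s; _≡ᵇ_; _<ᵇ_; _≟_; NonZero; _/_; _%_)
open import Data.Nat.Properties
open import Data.Nat.DivMod
open import Data.Nat.Divisibility using (n∣m*n)
open import Data.Nat.Induction using (<-rec; <-wellFounded)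
open import Data.Nat.ListAction using (sum)
open import Data.Nat.Tactic.RingSolver using (solve-∀)
open import Data.List using ([]; _∷_; map; upTo; applyUpTo)
open import Data.List.Properties using (map-upTo)
open import Data.Product using (Σ; ∃-syntax; _,_; _×_; proj₁; proj₂)
open import Data.Sum using (_⊎_; inj₁; inj₂)
open import Data.Empty using (⊥-elim)
open import Function using (_∘_; id)
open import Induction.WellFounded using (Acc; acc)
open import Relation.Binary.Definitions using (tri<; tri≈; tri>)
open import Relation.Binary.PropositionalEquality
import Relation.Binary.Reasoning.Setoid as SetoidReasoning
open import Relation.Nullary using (¬_; yes; no)

∑ : ℕ → (ℕ → Bool) → Bool
∑ zero    F = false
∑ (suc n) F = ∑ n F xor F n

∑-head : ∀ n F → ∑ (suc n) F ≡ F 0 xor ∑ n (F ∘ suc)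
∑-head zero F = sym (xor-identityʳ _)
∑-head (suc n) F = begin
  ∑ (suc n) F xor F (suc n)               ≡⟨ cong (_xor F (suc n)) (∑-head n F) ⟩
  (F 0 xor ∑ n (F ∘ suc)) xor F (suc n)   ≡⟨ xor-assoc (F 0) _ _ ⟩
  F 0 xor ∑ (suc n) (F ∘ suc)             ∎
  where open ≡-Reasoning

xsum-upTo : ∀ n (F : ℕ → Bool) → xsum (map F (upTo n)) ≡ ∑ n F
xsum-upTo n F = trans (cong xsum (map-upTo F n)) (go n F)
  where
  go : ∀ n F → xsum (applyUpTo F n) ≡ ∑ n F
  go zero F = refl
  go (suc n) F = trans (cong (F 0 xor_) (go n (F ∘ suc))) (sym (∑-head n F))

∑-cong< : ∀ n {F G : ℕ → Bool} → (∀ i → i < n → F i ≡ G i) → ∑ n F ≡ ∑ n G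
∑-cong< zero eq = refl
∑-cong< (suc n) eq = cong₂ _xor_ (∑-cong< n (λ i i<n → eq i (m<n⇒m<1+n i<n))) (eq n ≤-refl)

∑-cong : ∀ n {F G : ℕ → Bool} → (∀ i → F i ≡ G i) → ∑ n F ≡ ∑ n G
∑-cong n eq = ∑-cong< n (λ i _ → eq i)

∑-false : ∀ n {F : ℕ → Bool} → (∀ i → i < n → F i ≡ false) → ∑ n F ≡ false
∑-false zero eq = refl
∑-false (suc n) eq = cong₂ _xor_ (∑-false n (λ i i<n → eq i (m<n⇒m<1+n i<n))) (eq n ≤-refl)

∑-xor : ∀ n F G → ∑ n (λ i → F i xor G i) ≡ ∑ n F xor ∑ n G
∑-xor zero F G = refl
∑-xor (suc n) F G = trans (cong (_xor (F n xor G n)) (∑-xor n F G)) (interchange (∑ n F) (∑ n G) (F n) (G n))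

∧-distribˡ-∑ : ∀ n b F → b ∧ ∑ n F ≡ ∑ n (λ i → b ∧ F i)
∧-distribˡ-∑ zero b F = ∧-zeroʳ b
∧-distribˡ-∑ (suc n) b F = trans (∧-distribˡ-xor b (∑ n F) (F n)) (cong (_xor (b ∧ F n)) (∧-distribˡ-∑ n b F))

∧-distribʳ-∑ : ∀ n b F → ∑ n F ∧ b ≡ ∑ n (λ i → F i ∧ b)
∧-distribʳ-∑ n b F = trans (∧-comm (∑ n F) b) (trans (∧-distribˡ-∑ n b F) (∑-cong n (λ i → ∧-comm b (F i))))

∑-+ : ∀ m n F → ∑ (m + n) F ≡ ∑ m F xor ∑ n (λ i → F (m + i))
∑-+ m zero F = trans (cong (λ k → ∑ k F) (+-identityʳ m)) (sym (xor-identityʳ _))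
∑-+ m (suc n) F = begin
  ∑ (m + suc n) F                                  ≡⟨ cong (λ k → ∑ k F) (+-suc m n) ⟩
  ∑ (m + n) F xor F (m + n)                        ≡⟨ cong (_xor F (m + n)) (∑-+ m n F) ⟩
  (∑ m F xor ∑ n (λ i → F (m + i))) xor F (m + n)  ≡⟨ xor-assoc (∑ m F) _ _ ⟩
  ∑ m F xor ∑ (suc n) (λ i → F (m + i))            ∎
  where open ≡-Reasoning

∑-reverse : ∀ n F → ∑ n F ≡ ∑ n (λ i → F (n ∸ suc i))
∑-reverse zero F = refl
∑-reverse (suc n) F = begin
  ∑ n F xor F n                          ≡⟨ cong (_xor F n) (∑-reverse n F) ⟩
  ∑ n (λ i → F (n ∸ suc i)) xor F n      ≡⟨ xor-comm _ (F n) ⟩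
  F n xor ∑ n (λ i → F (n ∸ suc i))      ≡⟨ ∑-head n (λ i → F (suc n ∸ suc i)) ⟨
  ∑ (suc n) (λ i → F (suc n ∸ suc i))    ∎
  where open ≡-Reasoning

∑-swap : ∀ m n (F : ℕ → ℕ → Bool) → ∑ m (λ i → ∑ n (F i)) ≡ ∑ n (λ j → ∑ m (λ i → F i j))
∑-swap zero n F = sym (∑-false n (λ _ _ → refl))
∑-swap (suc m) n F = begin
  ∑ m (λ i → ∑ n (F i)) xor ∑ n (F m)          ≡⟨ cong (_xor ∑ n (F m)) (∑-swap m n F) ⟩
  ∑ n (λ j → ∑ m (λ i → F i j)) xor ∑ n (F m)  ≡⟨ ∑-xor n _ _ ⟨
  ∑ n (λ j → ∑ (suc m) (λ i → F i j))          ∎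
  where open ≡-Reasoning

∑-triangle : ∀ n (F : ℕ → ℕ → Bool) →
  ∑ (suc n) (λ i → ∑ (suc i) (F i)) ≡ ∑ (suc n) (λ j → ∑ (suc (n ∸ j)) (λ l → F (j + l) j))
∑-triangle zero F = refl
∑-triangle (suc n) F = begin
  ∑ (suc n) (λ i → ∑ (suc i) (F i)) xor ∑ (suc (suc n)) (F (suc n))
    ≡⟨ cong (_xor ∑ (suc (suc n)) (F (suc n))) (∑-triangle n F) ⟩
  R xor (∑ (suc n) (F (suc n)) xor F (suc n) (suc n))
    ≡⟨ xor-assoc R _ _ ⟨
  (R xor ∑ (suc n) (F (suc n))) xor F (suc n) (suc n)
    ≡⟨ cong (_xor F (suc n) (suc n)) (∑-xor (suc n) _ _) ⟨
  ∑ (suc n) (λ j → ∑ (suc (n ∸ j)) (λ l → F (j + l) j) xor F (suc n) j) xor F (suc n) (suc n)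
    ≡⟨ cong₂ _xor_ (∑-cong< (suc n) column) (cong (λ z → F z (suc n)) (sym (+-identityʳ (suc n)))) ⟩
  ∑ (suc n) (λ j → ∑ (suc (suc n ∸ j)) (λ l → F (j + l) j)) xor F (suc n + 0) (suc n)
    ≡⟨ cong (λ k → ∑ (suc n) (λ j → ∑ (suc (suc n ∸ j)) (λ l → F (j + l) j)) xor ∑ (suc k) (λ l → F (suc n + l) (suc n)))
            (n∸n≡0 n) ⟨
  ∑ (suc (suc n)) (λ j → ∑ (suc (suc n ∸ j)) (λ l → F (j + l) j)) ∎
  where
  open ≡-Reasoning
  R : Bool
  R = ∑ (suc n) (λ j → ∑ (suc (n ∸ j)) (λ l → F (j + l) j))
  column : ∀ j → j < suc n →
           ∑ (suc (n ∸ j)) (λ l → F (j + l) j) xor F (suc n) j ≡ ∑ (suc (suc n ∸ j)) (λ l → F (j + l) j)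
  column j j<1+n rewrite +-∸-assoc 1 (≤-pred j<1+n) =
    cong (λ z → ∑ (suc (n ∸ j)) (λ l → F (j + l) j) xor F z j)
      (sym (trans (+-suc j (n ∸ j)) (cong suc (m+[n∸m]≡n (≤-pred j<1+n)))))

module ≗-Reasoning = SetoidReasoning (ℕ →-setoid Bool)

mulS-∑ : ∀ f g n → mulS f g n ≡ ∑ (suc n) (λ i → f i ∧ g (n ∸ i))
mulS-∑ f g n = xsum-upTo (suc n) (λ i → f i ∧ g (n ∸ i))

mulS-cong : ∀ {f f′ g g′} → f ≗ f′ → g ≗ g′ → mulS f g ≗ mulS f′ g′
mulS-cong {f} {f′} {g} {g′} f≗f′ g≗g′ n = begin
  mulS f g n                              ≡⟨ mulS-∑ f g n ⟩
  ∑ (suc n) (λ i → f i ∧ g (n ∸ i))       ≡⟨ ∑-cong (suc n) (λ i → cong₂ _∧_ (f≗f′ i) (g≗g′ (n ∸ i))) ⟩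
  ∑ (suc n) (λ i → f′ i ∧ g′ (n ∸ i))     ≡⟨ mulS-∑ f′ g′ n ⟨
  mulS f′ g′ n                            ∎
  where open ≡-Reasoning

mulS-congˡ : ∀ f {g g′} → g ≗ g′ → mulS f g ≗ mulS f g′
mulS-congˡ f = mulS-cong {f} (λ _ → refl)

mulS-congʳ : ∀ {f f′} g → f ≗ f′ → mulS f g ≗ mulS f′ g
mulS-congʳ g f≗f′ = mulS-cong {g = g} f≗f′ (λ _ → refl)

addS-cong : ∀ {f f′ g g′} → f ≗ f′ → g ≗ g′ → addS f g ≗ addS f′ g′
addS-cong f≗f′ g≗g′ n = cong₂ _xor_ (f≗f′ n) (g≗g′ n)

mulS-comm : ∀ f g → mulS f g ≗ mulS g f
mulS-comm f g n = begin
  mulS f g n                                          ≡⟨ mulS-∑ f g n ⟩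
  ∑ (suc n) (λ i → f i ∧ g (n ∸ i))                   ≡⟨ ∑-reverse (suc n) _ ⟩
  ∑ (suc n) (λ i → f (n ∸ i) ∧ g (n ∸ (n ∸ i)))       ≡⟨ ∑-cong< (suc n) flip ⟩
  ∑ (suc n) (λ i → g i ∧ f (n ∸ i))                   ≡⟨ mulS-∑ g f n ⟨
  mulS g f n                                          ∎
  where
  open ≡-Reasoning
  flip : ∀ i → i < suc n → f (n ∸ i) ∧ g (n ∸ (n ∸ i)) ≡ g i ∧ f (n ∸ i)
  flip i i<1+n = trans (cong (λ z → f (n ∸ i) ∧ g z) (m∸[m∸n]≡n (≤-pred i<1+n))) (∧-comm (f (n ∸ i)) (g i))

mulS-distribˡ : ∀ f g h → mulS f (addS g h) ≗ addS (mulS f g) (mulS f h)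
mulS-distribˡ f g h n = begin
  mulS f (addS g h) n                                   ≡⟨ mulS-∑ f (addS g h) n ⟩
  ∑ (suc n) (λ i → f i ∧ (g (n ∸ i) xor h (n ∸ i)))     ≡⟨ ∑-cong (suc n) (λ i → ∧-distribˡ-xor (f i) _ _) ⟩
  ∑ (suc n) (λ i → (f i ∧ g (n ∸ i)) xor (f i ∧ h (n ∸ i)))
                                                        ≡⟨ ∑-xor (suc n) _ _ ⟩
  ∑ (suc n) (λ i → f i ∧ g (n ∸ i)) xor ∑ (suc n) (λ i → f i ∧ h (n ∸ i))
                                                        ≡⟨ cong₂ _xor_ (mulS-∑ f g n) (mulS-∑ f h n) ⟨
  addS (mulS f g) (mulS f h) n                          ∎
  where open ≡-Reasoning

mulS-distribʳ : ∀ f g h → mulS (addS g h) f ≗ addS (mulS g f) (mulS h f)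
mulS-distribʳ f g h n =
  trans (mulS-comm (addS g h) f n) (trans (mulS-distribˡ f g h n) (cong₂ _xor_ (mulS-comm f g n) (mulS-comm f h n)))

mulS-identityˡ : ∀ g → mulS oneS g ≗ g
mulS-identityˡ g n = begin
  mulS oneS g n                                       ≡⟨ mulS-∑ oneS g n ⟩
  ∑ (suc n) (λ i → oneS i ∧ g (n ∸ i))                ≡⟨ ∑-head n _ ⟩
  g n xor ∑ n (λ i → oneS (suc i) ∧ g (n ∸ suc i))    ≡⟨ cong (g n xor_) (∑-false n (λ _ _ → refl)) ⟩
  g n xor false                                       ≡⟨ xor-identityʳ (g n) ⟩
  g n                                                 ∎
  where open ≡-Reasoning

mulS-identityʳ : ∀ g → mulS g oneS ≗ g
mulS-identityʳ g n = trans (mulS-comm g oneS n) (mulS-identityˡ g n)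

mulS-zeroˡ : ∀ g → mulS zeroS g ≗ zeroS
mulS-zeroˡ g n = trans (mulS-∑ zeroS g n) (∑-false (suc n) (λ _ _ → refl))

mulS-zeroʳ : ∀ g → mulS g zeroS ≗ zeroS
mulS-zeroʳ g n = trans (mulS-comm g zeroS n) (mulS-zeroˡ g n)

mulS-assoc : ∀ f g h → mulS (mulS f g) h ≗ mulS f (mulS g h)
mulS-assoc f g h n = begin
  mulS (mulS f g) h n
    ≡⟨ mulS-∑ (mulS f g) h n ⟩
  ∑ (suc n) (λ i → mulS f g i ∧ h (n ∸ i))
    ≡⟨ ∑-cong (suc n) (λ i → trans (cong (_∧ h (n ∸ i)) (mulS-∑ f g i)) (∧-distribʳ-∑ (suc i) _ _)) ⟩
  ∑ (suc n) (λ i → ∑ (suc i) (λ j → (f j ∧ g (i ∸ j)) ∧ h (n ∸ i)))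
    ≡⟨ ∑-triangle n _ ⟩
  ∑ (suc n) (λ j → ∑ (suc (n ∸ j)) (λ l → (f j ∧ g (j + l ∸ j)) ∧ h (n ∸ (j + l))))
    ≡⟨ ∑-cong (suc n) (λ j → ∑-cong (suc (n ∸ j)) (λ l →
         trans (∧-assoc (f j) _ _) (cong₂ (λ a b → f j ∧ g a ∧ h b) (m+n∸m≡n j l) (sym (∸-+-assoc n j l))))) ⟩
  ∑ (suc n) (λ j → ∑ (suc (n ∸ j)) (λ l → f j ∧ (g l ∧ h (n ∸ j ∸ l))))
    ≡⟨ ∑-cong (suc n) (λ j → trans (cong (f j ∧_) (mulS-∑ g h (n ∸ j))) (∧-distribˡ-∑ (suc (n ∸ j)) _ _)) ⟨
  ∑ (suc n) (λ j → f j ∧ mulS g h (n ∸ j))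
    ≡⟨ mulS-∑ f (mulS g h) n ⟨
  mulS f (mulS g h) n ∎
  where open ≡-Reasoning

parity : ∀ n → Σ ℕ (λ m → n ≡ m + m ⊎ n ≡ suc (m + m))
parity zero = 0 , inj₁ refl
parity (suc n) with parity n
... | m , inj₁ n≡2m   = m , inj₂ (cong suc n≡2m)
... | m , inj₂ n≡2m+1 = suc m , inj₁ (trans (cong suc n≡2m+1) (cong suc (sym (+-suc m m))))

data Residue3 : ℕ → Set where
  rem0 : ∀ t → Residue3 (3 * t)
  rem1 : ∀ t → Residue3 (suc (3 * t))
  rem2 : ∀ t → Residue3 (suc (suc (3 * t)))

residue3 : ∀ n → Residue3 n
residue3 zero = rem0 0
residue3 (suc zero) = rem1 0
residue3 (suc (suc zero)) = rem2 0
residue3 (suc (suc (suc n))) with residue3 n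
... | rem0 t = subst Residue3 (*-suc 3 t) (rem0 (suc t))
... | rem1 t = subst Residue3 (cong suc (*-suc 3 t)) (rem1 (suc t))
... | rem2 t = subst Residue3 (cong (suc ∘ suc) (*-suc 3 t)) (rem2 (suc t))

-- V₂ f = f(q²) and V₃ f = f(q³); U₃ keeps the coefficients c(3n).
V₂ : Series → Series
V₂ f zero = f 0
V₂ f (suc zero) = false
V₂ f (suc (suc n)) = V₂ (f ∘ suc) n

V₃ : Series → Series
V₃ f zero = f 0
V₃ f (suc zero) = false
V₃ f (suc (suc zero)) = false
V₃ f (suc (suc (suc n))) = V₃ (f ∘ suc) n

U₃ : Series → Series
U₃ f n = f (3 * n)

V₂-even : ∀ f m → V₂ f (m + m) ≡ f m
V₂-even f zero = refl
V₂-even f (suc m) rewrite +-suc m m = V₂-even (f ∘ suc) m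

V₂-odd : ∀ f m → V₂ f (suc (m + m)) ≡ false
V₂-odd f zero = refl
V₂-odd f (suc m) rewrite +-suc m m = V₂-odd (f ∘ suc) m

V₂-cong : ∀ {f g} → f ≗ g → V₂ f ≗ V₂ g
V₂-cong f≗g zero = f≗g 0
V₂-cong f≗g (suc zero) = refl
V₂-cong f≗g (suc (suc n)) = V₂-cong (f≗g ∘ suc) n

V₂-addS : ∀ f g → V₂ (addS f g) ≗ addS (V₂ f) (V₂ g)
V₂-addS f g zero = refl
V₂-addS f g (suc zero) = refl
V₂-addS f g (suc (suc n)) = V₂-addS (f ∘ suc) (g ∘ suc) n

V₃-rem0 : ∀ f t → V₃ f (3 * t) ≡ f t
V₃-rem0 f zero = refl
V₃-rem0 f (suc t) = subst (λ k → V₃ f k ≡ f (suc t)) (sym (*-suc 3 t)) (V₃-rem0 (f ∘ suc) t)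

V₃-rem1 : ∀ f t → V₃ f (suc (3 * t)) ≡ false
V₃-rem1 f zero = refl
V₃-rem1 f (suc t) = subst (λ k → V₃ f (suc k) ≡ false) (sym (*-suc 3 t)) (V₃-rem1 (f ∘ suc) t)

V₃-rem2 : ∀ f t → V₃ f (suc (suc (3 * t))) ≡ false
V₃-rem2 f zero = refl
V₃-rem2 f (suc t) = subst (λ k → V₃ f (suc (suc k)) ≡ false) (sym (*-suc 3 t)) (V₃-rem2 (f ∘ suc) t)

V₃-cong : ∀ {f g} → f ≗ g → V₃ f ≗ V₃ g
V₃-cong f≗g zero = f≗g 0
V₃-cong f≗g (suc zero) = refl
V₃-cong f≗g (suc (suc zero)) = refl
V₃-cong f≗g (suc (suc (suc n))) = V₃-cong (f≗g ∘ suc) n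

U₃-cong : ∀ {f g} → f ≗ g → U₃ f ≗ U₃ g
U₃-cong f≗g n = f≗g (3 * n)

V₃-divisible : ∀ c n → (if n % 3 ≡ᵇ 0 then c (n / 3) else false) ≡ V₃ c n
V₃-divisible c zero = refl
V₃-divisible c (suc zero) = refl
V₃-divisible c (suc (suc zero)) = refl
V₃-divisible c (suc (suc (suc n))) rewrite m/n≡1+[m∸n]/n {suc (suc (suc n))} {3} (s≤s (s≤s (s≤s z≤n))) =
  V₃-divisible (c ∘ suc) n

T₃≗U₃+V₃ : ∀ c → T₃ c ≗ addS (U₃ c) (V₃ c)
T₃≗U₃+V₃ c n with n % 3 ≡ᵇ 0 | V₃-divisible c n
... | true  | eq = cong (c (3 * n) xor_) eq
... | false | eq = trans (sym (xor-identityʳ _)) (cong (c (3 * n) xor_) eq)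

∑-3* : ∀ m F → ∑ (3 * m) F ≡ ∑ m (λ t → F (3 * t) xor F (suc (3 * t)) xor F (suc (suc (3 * t))))
∑-3* zero F = refl
∑-3* (suc m) F = begin
  ∑ (3 * suc m) F
    ≡⟨ cong (λ k → ∑ k F) (*-suc 3 m) ⟩
  ((∑ (3 * m) F xor F (3 * m)) xor F (suc (3 * m))) xor F (suc (suc (3 * m)))
    ≡⟨ xor-assoc (∑ (3 * m) F xor F (3 * m)) _ _ ⟩
  (∑ (3 * m) F xor F (3 * m)) xor (F (suc (3 * m)) xor F (suc (suc (3 * m))))
    ≡⟨ xor-assoc (∑ (3 * m) F) _ _ ⟩
  ∑ (3 * m) F xor (F (3 * m) xor F (suc (3 * m)) xor F (suc (suc (3 * m))))
    ≡⟨ cong (_xor (F (3 * m) xor F (suc (3 * m)) xor F (suc (suc (3 * m))))) (∑-3* m F) ⟩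
  ∑ (suc m) (λ t → F (3 * t) xor F (suc (3 * t)) xor F (suc (suc (3 * t)))) ∎
  where open ≡-Reasoning

mulS-V₃-rem0 : ∀ g h m → mulS (V₃ g) h (3 * m) ≡ ∑ (suc m) (λ t → g t ∧ h (3 * m ∸ 3 * t))
mulS-V₃-rem0 g h m = begin
  mulS (V₃ g) h (3 * m)
    ≡⟨ mulS-∑ (V₃ g) h (3 * m) ⟩
  ∑ (3 * m) G xor G (3 * m)
    ≡⟨ cong₂ _xor_ (∑-3* m G) (cong (_∧ h (3 * m ∸ 3 * m)) (V₃-rem0 g m)) ⟩
  ∑ m (λ t → G (3 * t) xor G (suc (3 * t)) xor G (suc (suc (3 * t)))) xor (g m ∧ h (3 * m ∸ 3 * m))
    ≡⟨ cong (_xor (g m ∧ h (3 * m ∸ 3 * m))) (∑-cong m block) ⟩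
  ∑ (suc m) (λ t → g t ∧ h (3 * m ∸ 3 * t)) ∎
  where
  open ≡-Reasoning
  G : ℕ → Bool
  G i = V₃ g i ∧ h (3 * m ∸ i)
  block : ∀ t → G (3 * t) xor G (suc (3 * t)) xor G (suc (suc (3 * t))) ≡ g t ∧ h (3 * m ∸ 3 * t)
  block t rewrite V₃-rem0 g t | V₃-rem1 g t | V₃-rem2 g t = xor-identityʳ _

mulS-V₃-rem1 : ∀ g h m → mulS (V₃ g) (V₃ h) (suc (3 * m)) ≡ false
mulS-V₃-rem1 g h m = begin
  mulS (V₃ g) (V₃ h) (suc (3 * m))
    ≡⟨ mulS-∑ (V₃ g) (V₃ h) (suc (3 * m)) ⟩
  (∑ (3 * m) G xor G (3 * m)) xor G (suc (3 * m))
    ≡⟨ cong₂ _xor_ (cong₂ _xor_ (trans (∑-3* m G) (∑-false m block)) (cong (_∧ V₃ h (suc (3 * m) ∸ 3 * m)) (V₃-rem0 g m)))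
                   (cong (_∧ V₃ h (suc (3 * m) ∸ suc (3 * m))) (V₃-rem1 g m)) ⟩
  (false xor (g m ∧ V₃ h (suc (3 * m) ∸ 3 * m))) xor false
    ≡⟨ cong (λ k → (false xor (g m ∧ V₃ h k)) xor false) (trans (+-∸-assoc 1 {3 * m} ≤-refl) (cong suc (n∸n≡0 (3 * m)))) ⟩
  (false xor (g m ∧ false)) xor false
    ≡⟨ cong (λ z → (false xor z) xor false) (∧-zeroʳ (g m)) ⟩
  false ∎
  where
  open ≡-Reasoning
  G : ℕ → Bool
  G i = V₃ g i ∧ V₃ h (suc (3 * m) ∸ i)
  block : ∀ t → t < m → (G (3 * t) xor G (suc (3 * t)) xor G (suc (suc (3 * t)))) ≡ false
  block t t<m rewrite V₃-rem1 g t | V₃-rem2 g t | +-∸-assoc 1 (*-monoʳ-≤ 3 (<⇒≤ t<m))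
                    | sym (*-distribˡ-∸ 3 m t) | V₃-rem1 h (m ∸ t) =
    trans (xor-identityʳ (V₃ g (3 * t) ∧ false)) (∧-zeroʳ (V₃ g (3 * t)))

mulS-V₃-rem2 : ∀ g h m → mulS (V₃ g) (V₃ h) (suc (suc (3 * m))) ≡ false
mulS-V₃-rem2 g h m = begin
  mulS (V₃ g) (V₃ h) (suc (suc (3 * m))) ≡⟨ mulS-∑ (V₃ g) (V₃ h) (suc (suc (3 * m))) ⟩
  ∑ (suc (suc (suc (3 * m)))) G          ≡⟨ cong (λ k → ∑ k G) (*-suc 3 m) ⟨
  ∑ (3 * suc m) G                        ≡⟨ trans (∑-3* (suc m) G) (∑-false (suc m) block) ⟩
  false                                  ∎
  where
  open ≡-Reasoning
  G : ℕ → Bool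
  G i = V₃ g i ∧ V₃ h (suc (suc (3 * m)) ∸ i)
  block : ∀ t → t < suc m → (G (3 * t) xor G (suc (3 * t)) xor G (suc (suc (3 * t)))) ≡ false
  block t t<1+m rewrite V₃-rem1 g t | V₃-rem2 g t | +-∸-assoc 2 (*-monoʳ-≤ 3 (≤-pred t<1+m))
                      | sym (*-distribˡ-∸ 3 m t) | V₃-rem2 h (m ∸ t) =
    trans (xor-identityʳ (V₃ g (3 * t) ∧ false)) (∧-zeroʳ (V₃ g (3 * t)))

V₃-mulS : ∀ f g → V₃ (mulS f g) ≗ mulS (V₃ f) (V₃ g)
V₃-mulS f g n with residue3 n
... | rem0 m = begin
  V₃ (mulS f g) (3 * m)                       ≡⟨ V₃-rem0 _ m ⟩
  mulS f g m                                  ≡⟨ mulS-∑ f g m ⟩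
  ∑ (suc m) (λ t → f t ∧ g (m ∸ t))           ≡⟨ ∑-cong< (suc m) spread ⟩
  ∑ (suc m) (λ t → f t ∧ V₃ g (3 * m ∸ 3 * t)) ≡⟨ mulS-V₃-rem0 f (V₃ g) m ⟨
  mulS (V₃ f) (V₃ g) (3 * m)                  ∎
  where
  open ≡-Reasoning
  spread : ∀ t → t < suc m → f t ∧ g (m ∸ t) ≡ f t ∧ V₃ g (3 * m ∸ 3 * t)
  spread t _ = cong (f t ∧_) (trans (sym (V₃-rem0 g (m ∸ t))) (cong (V₃ g) (*-distribˡ-∸ 3 m t)))
... | rem1 m = trans (V₃-rem1 _ m) (sym (mulS-V₃-rem1 f g m))
... | rem2 m = trans (V₃-rem2 _ m) (sym (mulS-V₃-rem2 f g m))

U₃-mulS-V₃ : ∀ f g → U₃ (mulS f (V₃ g)) ≗ mulS g (U₃ f)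
U₃-mulS-V₃ f g n = begin
  mulS f (V₃ g) (3 * n)                       ≡⟨ mulS-comm f (V₃ g) (3 * n) ⟩
  mulS (V₃ g) f (3 * n)                       ≡⟨ mulS-V₃-rem0 g f n ⟩
  ∑ (suc n) (λ t → g t ∧ f (3 * n ∸ 3 * t))   ≡⟨ ∑-cong (suc n) (λ t → cong (λ k → g t ∧ f k) (sym (*-distribˡ-∸ 3 n t))) ⟩
  ∑ (suc n) (λ t → g t ∧ U₃ f (n ∸ t))        ≡⟨ mulS-∑ g (U₃ f) n ⟨
  mulS g (U₃ f) n                             ∎
  where open ≡-Reasoning

∑-symmetric-even-length : ∀ m G → (∀ i → i ≤ m → G (suc (m + m) ∸ i) ≡ G i) → ∑ (suc (suc (m + m))) G ≡ false
∑-symmetric-even-length m G sym-G = begin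
  ∑ (suc (suc (m + m))) G                            ≡⟨ cong (λ k → ∑ (suc k) G) (+-suc m m) ⟨
  ∑ (suc m + suc m) G                                ≡⟨ ∑-+ (suc m) (suc m) G ⟩
  ∑ (suc m) G xor ∑ (suc m) (λ i → G (suc m + i))    ≡⟨ cong (∑ (suc m) G xor_) (∑-reverse (suc m) _) ⟩
  ∑ (suc m) G xor ∑ (suc m) (λ i → G (suc m + (m ∸ i)))
    ≡⟨ cong (∑ (suc m) G xor_) (∑-cong< (suc m) (λ i i<1+m →
         trans (cong G (sym (+-∸-assoc (suc m) (≤-pred i<1+m)))) (sym-G i (≤-pred i<1+m)))) ⟩
  ∑ (suc m) G xor ∑ (suc m) G                        ≡⟨ xor-same (∑ (suc m) G) ⟩
  false                                              ∎
  where open ≡-Reasoning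

∑-symmetric-odd-length : ∀ m G → (∀ i → i < m → G ((m + m) ∸ i) ≡ G i) → ∑ (suc (m + m)) G ≡ G m
∑-symmetric-odd-length m G sym-G = begin
  ∑ (suc (m + m)) G                                  ≡⟨ cong (λ k → ∑ k G) (+-suc m m) ⟨
  ∑ (m + suc m) G                                    ≡⟨ ∑-+ m (suc m) G ⟩
  ∑ m G xor ∑ (suc m) (λ i → G (m + i))              ≡⟨ cong (∑ m G xor_) (∑-head m _) ⟩
  ∑ m G xor (G (m + 0) xor ∑ m (λ i → G (m + suc i)))
    ≡⟨ cong (λ z → ∑ m G xor (G (m + 0) xor z)) (∑-reverse m _) ⟩
  ∑ m G xor (G (m + 0) xor ∑ m (λ i → G (m + suc (m ∸ suc i))))
    ≡⟨ cong₂ (λ a b → ∑ m G xor (G a xor b)) (+-identityʳ m) (∑-cong< m mirror) ⟩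
  ∑ m G xor (G m xor ∑ m G)                          ≡⟨ cong (∑ m G xor_) (xor-comm (G m) _) ⟩
  ∑ m G xor (∑ m G xor G m)                          ≡⟨ xor-assoc (∑ m G) _ _ ⟨
  (∑ m G xor ∑ m G) xor G m                          ≡⟨ cong (_xor G m) (xor-same (∑ m G)) ⟩
  G m                                                ∎
  where
  open ≡-Reasoning
  mirror : ∀ i → i < m → G (m + suc (m ∸ suc i)) ≡ G i
  mirror i i<m = trans (cong (λ k → G (m + k)) (sym (+-∸-assoc 1 i<m)))
                       (trans (cong G (sym (+-∸-assoc m (<⇒≤ i<m)))) (sym-G i i<m))

mulS-square : ∀ f → mulS f f ≗ V₂ f
mulS-square f n with parity n
... | m , inj₁ refl = trans (mulS-∑ f f (m + m)) (trans (∑-symmetric-odd-length m _ swap)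
                        (trans (cong (λ k → f m ∧ f k) (m+n∸m≡n m m)) (trans (∧-idem (f m)) (sym (V₂-even f m)))))
  where
  swap : ∀ i → i < m → f (m + m ∸ i) ∧ f (m + m ∸ (m + m ∸ i)) ≡ f i ∧ f (m + m ∸ i)
  swap i i<m = trans (cong (λ k → f (m + m ∸ i) ∧ f k) (m∸[m∸n]≡n (≤-trans (<⇒≤ i<m) (m≤m+n m m)))) (∧-comm _ (f i))
... | m , inj₂ refl = trans (mulS-∑ f f _) (trans (∑-symmetric-even-length m _ swap) (sym (V₂-odd f m)))
  where
  swap : ∀ i → i ≤ m → f (suc (m + m) ∸ i) ∧ f (suc (m + m) ∸ (suc (m + m) ∸ i)) ≡ f i ∧ f (suc (m + m) ∸ i)
  swap i i≤m = trans (cong (λ k → f (suc (m + m) ∸ i) ∧ f k) (m∸[m∸n]≡n (≤-trans i≤m (≤-trans (m≤m+n m m) (n≤1+n _)))))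
                     (∧-comm _ (f i))

U₃-V₂ : ∀ f → U₃ (V₂ f) ≗ V₂ (U₃ f)
U₃-V₂ f n with parity n
... | m , inj₁ refl = trans (cong (V₂ f) (*-distribˡ-+ 3 m m)) (trans (V₂-even f (3 * m)) (sym (V₂-even (U₃ f) m)))
... | m , inj₂ refl = trans (cong (V₂ f) 3[2m+1]) (trans (V₂-odd f (suc (3 * m))) (sym (V₂-odd (U₃ f) m)))
  where
  3[2m+1] : 3 * suc (m + m) ≡ suc (suc (3 * m) + suc (3 * m))
  3[2m+1] = trans (*-suc 3 (m + m)) (cong (suc ∘ suc) (trans (cong suc (*-distribˡ-+ 3 m m)) (sym (+-suc (3 * m) (3 * m)))))

T₃-square : ∀ f → T₃ (mulS f f) ≗ mulS (T₃ f) (T₃ f)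
T₃-square f n = begin
  T₃ (mulS f f) n                        ≡⟨ T₃≗U₃+V₃ (mulS f f) n ⟩
  U₃ (mulS f f) n xor V₃ (mulS f f) n    ≡⟨ cong₂ _xor_ (mulS-square f (3 * n)) (V₃-mulS f f n) ⟩
  U₃ (V₂ f) n xor mulS (V₃ f) (V₃ f) n   ≡⟨ cong₂ _xor_ (U₃-V₂ f n) (mulS-square (V₃ f) n) ⟩
  V₂ (U₃ f) n xor V₂ (V₃ f) n            ≡⟨ V₂-addS (U₃ f) (V₃ f) n ⟨
  V₂ (addS (U₃ f) (V₃ f)) n              ≡⟨ V₂-cong (T₃≗U₃+V₃ f) n ⟨
  V₂ (T₃ f) n                            ≡⟨ mulS-square (T₃ f) n ⟨
  mulS (T₃ f) (T₃ f) n                   ∎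
  where open ≡-Reasoning

T₃-cong : ∀ {f g} → f ≗ g → T₃ f ≗ T₃ g
T₃-cong {f} {g} f≗g n =
  trans (T₃≗U₃+V₃ f n) (trans (addS-cong (U₃-cong f≗g) (V₃-cong f≗g) n) (sym (T₃≗U₃+V₃ g n)))

≡ᵇ-true : ∀ {m n} → m ≡ n → (m ≡ᵇ n) ≡ true
≡ᵇ-true {zero} refl = refl
≡ᵇ-true {suc m} refl = ≡ᵇ-true {m} refl

≡ᵇ-sound : ∀ m n → (m ≡ᵇ n) ≡ true → m ≡ n
≡ᵇ-sound zero zero _ = refl
≡ᵇ-sound (suc m) (suc n) eq = cong suc (≡ᵇ-sound m n eq)

≡ᵇ-false : ∀ {m n} → m ≢ n → (m ≡ᵇ n) ≡ false
≡ᵇ-false {m} {n} m≢n with m ≡ᵇ n in eq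
... | true = ⊥-elim (m≢n (≡ᵇ-sound m n eq))
... | false = refl

<ᵇ-true : ∀ {m n} → m < n → (m <ᵇ n) ≡ true
<ᵇ-true {zero} {suc n} _ = refl
<ᵇ-true {suc m} {suc n} (s≤s m<n) = <ᵇ-true {m} {n} m<n

<ᵇ-sound : ∀ m n → (m <ᵇ n) ≡ true → m < n
<ᵇ-sound zero (suc n) _ = s≤s z≤n
<ᵇ-sound (suc m) (suc n) eq = s≤s (<ᵇ-sound m n eq)

<ᵇ-false : ∀ {m n} → ¬ (m < n) → (m <ᵇ n) ≡ false
<ᵇ-false {m} {n} m≮n with m <ᵇ n in eq
... | true = ⊥-elim (m≮n (<ᵇ-sound m n eq))
... | false = refl

bool-ext : ∀ {a b : Bool} → (a ≡ true → b ≡ true) → (b ≡ true → a ≡ true) → a ≡ b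
bool-ext {true} {true} _ _ = refl
bool-ext {true} {false} a⇒b _ = sym (a⇒b refl)
bool-ext {false} {true} _ b⇒a = b⇒a refl
bool-ext {false} {false} _ _ = refl

∧-true : ∀ {a b} → a ∧ b ≡ true → a ≡ true × b ≡ true
∧-true {true} {true} _ = refl , refl

xor≡false⇒≡ : ∀ {a b} → a xor b ≡ false → a ≡ b
xor≡false⇒≡ {false} {false} _ = refl
xor≡false⇒≡ {true} {true} _ = refl

xor-cancelˡ : ∀ a b → a xor (a xor b) ≡ b
xor-cancelˡ a b = trans (sym (xor-assoc a a b)) (cong (_xor b) (xor-same a))

-- Parity of a sum under an involution
∑-indicator : ∀ N c (X : ℕ → Bool) → ∑ N (λ i → (c ≡ᵇ i) ∧ X i) ≡ (c <ᵇ N) ∧ X c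
∑-indicator zero c X = refl
∑-indicator (suc N) c X with <-cmp c N
... | tri< c<N c≢N _ = begin
  ∑ N (λ i → (c ≡ᵇ i) ∧ X i) xor ((c ≡ᵇ N) ∧ X N) ≡⟨ cong₂ _xor_ (∑-indicator N c X) (cong (_∧ X N) (≡ᵇ-false c≢N)) ⟩
  ((c <ᵇ N) ∧ X c) xor false                      ≡⟨ xor-identityʳ _ ⟩
  (c <ᵇ N) ∧ X c                                  ≡⟨ cong (_∧ X c) (trans (<ᵇ-true c<N) (sym (<ᵇ-true (m<n⇒m<1+n c<N)))) ⟩
  (c <ᵇ suc N) ∧ X c                              ∎
  where open ≡-Reasoning
... | tri≈ _ refl _ = begin
  ∑ N (λ i → (c ≡ᵇ i) ∧ X i) xor ((c ≡ᵇ c) ∧ X c) ≡⟨ cong₂ _xor_ (∑-indicator N c X) (cong (_∧ X c) (≡ᵇ-true {c} refl)) ⟩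
  ((c <ᵇ c) ∧ X c) xor X c                        ≡⟨ cong (λ z → (z ∧ X c) xor X c) (<ᵇ-false (n≮n c)) ⟩
  X c                                             ≡⟨ cong (_∧ X c) (sym (<ᵇ-true (n<1+n c))) ⟩
  (c <ᵇ suc c) ∧ X c                              ∎
  where open ≡-Reasoning
... | tri> _ c≢N N<c = begin
  ∑ N (λ i → (c ≡ᵇ i) ∧ X i) xor ((c ≡ᵇ N) ∧ X N) ≡⟨ cong₂ _xor_ (∑-indicator N c X) (cong (_∧ X N) (≡ᵇ-false c≢N)) ⟩
  ((c <ᵇ N) ∧ X c) xor false                      ≡⟨ cong (λ z → (z ∧ X c) xor false) (<ᵇ-false (<⇒≯ N<c)) ⟩
  false                                           ≡⟨ cong (_∧ X c) (sym (<ᵇ-false (λ c<1+N → <⇒≱ N<c (≤-pred c<1+N)))) ⟩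
  (c <ᵇ suc N) ∧ X c                              ∎
  where open ≡-Reasoning

∑-indicator< : ∀ N c (X : ℕ → Bool) → c < N → ∑ N (λ i → (c ≡ᵇ i) ∧ X i) ≡ X c
∑-indicator< N c X c<N = trans (∑-indicator N c X) (cong (_∧ X c) (<ᵇ-true c<N))

∑-differ-at : ∀ N y (F F′ : ℕ → Bool) → y < N → (∀ i → i ≢ y → F i ≡ F′ i) →
              ∑ N F ≡ ∑ N F′ xor (F y xor F′ y)
∑-differ-at N y F F′ y<N agree = begin
  ∑ N F                                            ≡⟨ xor-cancelˡ (∑ N F′) (∑ N F) ⟨
  ∑ N F′ xor (∑ N F′ xor ∑ N F)                    ≡⟨ cong (∑ N F′ xor_) (trans (xor-comm (∑ N F′) _) (sym (∑-xor N F F′))) ⟩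
  ∑ N F′ xor ∑ N (λ i → F i xor F′ i)              ≡⟨ cong (∑ N F′ xor_) (∑-cong N only-y) ⟩
  ∑ N F′ xor ∑ N (λ i → (y ≡ᵇ i) ∧ (F i xor F′ i)) ≡⟨ cong (∑ N F′ xor_) (∑-indicator< N y _ y<N) ⟩
  ∑ N F′ xor (F y xor F′ y)                        ∎
  where
  open ≡-Reasoning
  only-y : ∀ i → (F i xor F′ i) ≡ ((y ≡ᵇ i) ∧ (F i xor F′ i))
  only-y i with i ≟ y
  ... | yes refl = cong (_∧ (F i xor F′ i)) (sym (≡ᵇ-true {i} refl))
  ... | no i≢y = trans (cong (_xor F′ i) (agree i i≢y))
                       (trans (xor-same (F′ i)) (cong (_∧ (F i xor F′ i)) (sym (≡ᵇ-false (λ e → i≢y (sym e))))))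

module DropTransposition (N : ℕ) (σ : ℕ → ℕ) (σσ≡id : ∀ x → x < suc N → σ (σ x) ≡ x)
                         (maps : ∀ x → x < suc N → σ x < suc N) (σN<N : σ N < N) where

  y : ℕ
  y = σ N

  σ′ : ℕ → ℕ
  σ′ x with x ≟ y
  ... | yes _ = y
  ... | no _ = σ x

  σ′y≡y : σ′ y ≡ y
  σ′y≡y with y ≟ y
  ... | yes _ = refl
  ... | no y≢y = ⊥-elim (y≢y refl)

  σ′-agrees : ∀ i → i ≢ y → σ i ≡ σ′ i
  σ′-agrees i i≢y with i ≟ y
  ... | yes i≡y = ⊥-elim (i≢y i≡y)
  ... | no _ = refl

  σ′-maps : ∀ x → x < N → σ′ x < N
  σ′-maps x x<N with x ≟ y
  ... | yes _ = σN<N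
  ... | no x≢y with <-cmp (σ x) N
  ...   | tri< σx<N _ _ = σx<N
  ...   | tri≈ _ σx≡N _ = ⊥-elim (x≢y (trans (sym (σσ≡id x (m<n⇒m<1+n x<N))) (cong σ σx≡N)))
  ...   | tri> _ _ N<σx = ⊥-elim (<⇒≱ N<σx (≤-pred (maps x (m<n⇒m<1+n x<N))))

  σ′σ′≡id : ∀ x → x < N → σ′ (σ′ x) ≡ x
  σ′σ′≡id x x<N with x ≟ y
  ... | yes refl = σ′y≡y
  ... | no x≢y with σ x ≟ y
  ...   | yes σx≡y = ⊥-elim (<⇒≢ x<N (trans (sym (σσ≡id x (m<n⇒m<1+n x<N))) (trans (cong σ σx≡y) (σσ≡id N ≤-refl))))
  ...   | no _ = σσ≡id x (m<n⇒m<1+n x<N)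

∑-involution : ∀ N (G : ℕ → Bool) (σ : ℕ → ℕ) → (∀ x → x < N → σ x < N) → (∀ x → x < N → σ (σ x) ≡ x) →
               ∑ N (G ∘ σ) ≡ ∑ N G
∑-involution zero G σ maps σσ≡id = refl
∑-involution (suc N) G σ maps σσ≡id with <-cmp (σ N) N
... | tri> _ _ N<σN = ⊥-elim (<⇒≱ N<σN (≤-pred (maps N ≤-refl)))
... | tri≈ _ σN≡N _ =
  cong₂ _xor_ (∑-involution N G σ maps′ (λ x x<N → σσ≡id x (m<n⇒m<1+n x<N))) (cong G σN≡N)
  where
  maps′ : ∀ x → x < N → σ x < N
  maps′ x x<N with <-cmp (σ x) N
  ... | tri< σx<N _ _ = σx<N
  ... | tri≈ _ σx≡N _ = ⊥-elim (<⇒≢ x<N (trans (sym (σσ≡id x (m<n⇒m<1+n x<N))) (trans (cong σ σx≡N) σN≡N)))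
  ... | tri> _ _ N<σx = ⊥-elim (<⇒≱ N<σx (≤-pred (maps x (m<n⇒m<1+n x<N))))
... | tri< σN<N _ _ = begin
  ∑ N (G ∘ σ) xor G y
    ≡⟨ cong (_xor G y) (∑-differ-at N y (G ∘ σ) (G ∘ σ′) σN<N (λ i i≢y → cong G (σ′-agrees i i≢y))) ⟩
  (∑ N (G ∘ σ′) xor (G (σ y) xor G (σ′ y))) xor G y
    ≡⟨ cong₂ (λ u v → (∑ N (G ∘ σ′) xor (G u xor G v)) xor G y) (σσ≡id N ≤-refl) σ′y≡y ⟩
  (∑ N (G ∘ σ′) xor (G N xor G y)) xor G y
    ≡⟨ xor-assoc (∑ N (G ∘ σ′)) _ _ ⟩
  ∑ N (G ∘ σ′) xor ((G N xor G y) xor G y)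
    ≡⟨ cong (∑ N (G ∘ σ′) xor_) (trans (xor-assoc (G N) _ _) (trans (cong (G N xor_) (xor-same (G y))) (xor-identityʳ _))) ⟩
  ∑ N (G ∘ σ′) xor G N
    ≡⟨ cong (_xor G N) (∑-involution N G σ′ σ′-maps σ′σ′≡id) ⟩
  ∑ N G xor G N ∎
  where
  open ≡-Reasoning
  open DropTransposition N σ σσ≡id maps σN<N

module OnSupport (N : ℕ) (F : ℕ → Bool) (σ : ℕ → ℕ)
                 (maps : ∀ x → x < N → F x ≡ true → σ x < N)
                 (keeps : ∀ x → x < N → F x ≡ true → F (σ x) ≡ true)
                 (σσ≡id : ∀ x → x < N → F x ≡ true → σ (σ x) ≡ x) where

  τ : ℕ → ℕ
  τ x = if F x then σ x else x

  F∘τ : ∀ x → x < N → F (τ x) ≡ F x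
  F∘τ x x<N with F x in Fx
  ... | true = keeps x x<N Fx
  ... | false = Fx

  τ-maps : ∀ x → x < N → τ x < N
  τ-maps x x<N with F x in Fx
  ... | true = maps x x<N Fx
  ... | false = x<N

  ττ≡id : ∀ x → x < N → τ (τ x) ≡ x
  ττ≡id x x<N with F x in Fx
  ... | false rewrite Fx = refl
  ... | true rewrite keeps x x<N Fx = σσ≡id x x<N Fx

-- An involution pairs off the non-fixed points of F, so only the fixed points count mod 2.
∑-fixed-points : ∀ N (F : ℕ → Bool) (σ : ℕ → ℕ) →
                 (∀ x → x < N → F x ≡ true → σ x < N) →
                 (∀ x → x < N → F x ≡ true → F (σ x) ≡ true) →
                 (∀ x → x < N → F x ≡ true → σ (σ x) ≡ x) →
                 ∑ N F ≡ ∑ N (λ x → F x ∧ (σ x ≡ᵇ x))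
∑-fixed-points N F σ maps keeps σσ≡id = begin
  ∑ N F
    ≡⟨ ∑-cong N trichotomy ⟩
  ∑ N (λ x → Fix x xor (Down x xor Up x))
    ≡⟨ trans (∑-xor N _ _) (cong (∑ N Fix xor_) (∑-xor N _ _)) ⟩
  ∑ N Fix xor (∑ N Down xor ∑ N Up)
    ≡⟨ cong (λ z → ∑ N Fix xor (z xor ∑ N Up)) (trans (sym (∑-involution N Down τ τ-maps ττ≡id)) (∑-cong< N swap)) ⟩
  ∑ N Fix xor (∑ N Up xor ∑ N Up)
    ≡⟨ cong (∑ N Fix xor_) (xor-same (∑ N Up)) ⟩
  ∑ N Fix xor false
    ≡⟨ xor-identityʳ _ ⟩
  ∑ N Fix
    ≡⟨ ∑-cong N τ-fixed ⟩
  ∑ N (λ x → F x ∧ (σ x ≡ᵇ x)) ∎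
  where
  open ≡-Reasoning
  open OnSupport N F σ maps keeps σσ≡id
  Fix Down Up : ℕ → Bool
  Fix x = F x ∧ (τ x ≡ᵇ x)
  Down x = F x ∧ (τ x <ᵇ x)
  Up x = F x ∧ (x <ᵇ τ x)
  trichotomy : ∀ x → F x ≡ Fix x xor (Down x xor Up x)
  trichotomy x with F x
  ... | false = refl
  ... | true with <-cmp (σ x) x
  ...   | tri< p q r rewrite ≡ᵇ-false q | <ᵇ-true p | <ᵇ-false r = refl
  ...   | tri≈ p q r rewrite ≡ᵇ-true q | <ᵇ-false p | <ᵇ-false r = refl
  ...   | tri> p q r rewrite ≡ᵇ-false q | <ᵇ-true r | <ᵇ-false p = refl
  swap : ∀ x → x < N → Down (τ x) ≡ Up x
  swap x x<N = cong₂ (λ a b → a ∧ (b <ᵇ τ x)) (F∘τ x x<N) (ττ≡id x x<N)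
  τ-fixed : ∀ x → Fix x ≡ F x ∧ (σ x ≡ᵇ x)
  τ-fixed x with F x
  ... | true = refl
  ... | false = refl

-- Odd solutions of n = a² + 3b²
∑-true⇒ : ∀ N F → ∑ N F ≡ true → Σ ℕ (λ i → i < N × F i ≡ true)
∑-true⇒ (suc N) F eq with F N in FN
... | true = N , ≤-refl , FN
... | false with ∑-true⇒ N F (trans (sym (xor-identityʳ _)) eq)
...   | i , i<N , Fi = i , m<n⇒m<1+n i<N , Fi

∑-single : ∀ N F c → c < N → (∀ i → i < N → F i ≡ (c ≡ᵇ i)) → ∑ N F ≡ true
∑-single N F c c<N F≡ = trans (∑-cong< N (λ i i<N → trans (F≡ i i<N) (sym (∧-identityʳ _)))) (∑-indicator< N c (λ _ → true) c<N)

any-true⇒ : ∀ (p : ℕ → Bool) f N → any p (applyUpTo f N) ≡ true → Σ ℕ (λ i → i < N × p (f i) ≡ true)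
any-true⇒ p f (suc N) eq with p (f 0) in p0
... | true = 0 , s≤s z≤n , p0
... | false with any-true⇒ p (f ∘ suc) N eq
...   | i , i<N , pi = suc i , s≤s i<N , pi

any-true⇐ : ∀ (p : ℕ → Bool) f N i → i < N → p (f i) ≡ true → any p (applyUpTo f N) ≡ true
any-true⇐ p f (suc N) zero _ pi rewrite pi = refl
any-true⇐ p f (suc N) (suc i) (s≤s i<N) pi rewrite any-true⇐ p (f ∘ suc) N i i<N pi = ∨-zeroʳ _

isOdd : ℕ → Bool
isOdd zero = false
isOdd (suc zero) = true
isOdd (suc (suc n)) = isOdd n

isOdd-double : ∀ t → isOdd (t + t) ≡ false
isOdd-double zero = refl
isOdd-double (suc t) rewrite +-suc t t = isOdd-double t

isOdd-suc-double : ∀ t → isOdd (suc (t + t)) ≡ true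
isOdd-suc-double zero = refl
isOdd-suc-double (suc t) rewrite +-suc t t = isOdd-suc-double t

isOdd⇒ : ∀ a → isOdd a ≡ true → Σ ℕ (λ m → a ≡ suc (m + m))
isOdd⇒ a odd with parity a
... | m , inj₂ refl = m , refl
... | m , inj₁ refl with trans (sym (isOdd-double m)) odd
...   | ()

double≢suc-double : ∀ x y → x + x ≢ suc (y + y)
double≢suc-double x y eq with trans (sym (isOdd-double x)) (trans (cong isOdd eq) (isOdd-suc-double y))
... | ()

square-injective : ∀ a b → a * a ≡ b * b → a ≡ b
square-injective a b eq with <-cmp a b
... | tri< a<b _ _ = ⊥-elim (<⇒≢ (*-mono-< a<b a<b) eq)
... | tri≈ _ a≡b _ = a≡b
... | tri> _ _ b<a = ⊥-elim (<⇒≢ (*-mono-< b<a b<a) (sym eq))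

n≤n*n : ∀ n → n ≤ n * n
n≤n*n zero = z≤n
n≤n*n (suc n) = m≤m*n (suc n) (suc n)

Δ-true⇒ : ∀ x → Δ x ≡ true → Σ ℕ (λ m → suc (m + m) * suc (m + m) ≡ x)
Δ-true⇒ x eq with any-true⇒ (λ m → ((2 * m + 1) * (2 * m + 1)) ≡ᵇ x) id (suc x) eq
... | m , _ , sq≡x = m , subst (λ z → z * z ≡ x) (2m+1≡ m) (≡ᵇ-sound _ _ sq≡x)
  where
  2m+1≡ : ∀ m → 2 * m + 1 ≡ suc (m + m)
  2m+1≡ = solve-∀

Δ-odd-square : ∀ x m → suc (m + m) * suc (m + m) ≡ x → Δ x ≡ true
Δ-odd-square x m sq≡x = any-true⇐ (λ m → ((2 * m + 1) * (2 * m + 1)) ≡ᵇ x) id (suc x) m m<1+x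
  (≡ᵇ-true (trans (cong (λ z → z * z) (2m+1≡ m)) sq≡x))
  where
  2m+1≡ : ∀ m → 2 * m + 1 ≡ suc (m + m)
  2m+1≡ = solve-∀
  m<1+x : m < suc x
  m<1+x = s≤s (≤-trans (≤-trans (m≤m+n m m) (n≤1+n _)) (≤-trans (n≤n*n (suc (m + m))) (≤-reflexive sq≡x)))

Δ≡∑ : ∀ N x → x < N → Δ x ≡ ∑ N (λ a → isOdd a ∧ (a * a ≡ᵇ x))
Δ≡∑ N x x<N = bool-ext to from
  where
  to : Δ x ≡ true → ∑ N (λ a → isOdd a ∧ (a * a ≡ᵇ x)) ≡ true
  to Δx with Δ-true⇒ x Δx
  ... | m , sq≡x = ∑-single N _ c c<N only-c
    where
    c : ℕ
    c = suc (m + m)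
    c<N : c < N
    c<N = ≤-<-trans (≤-trans (n≤n*n c) (≤-reflexive sq≡x)) x<N
    only-c : ∀ i → i < N → (isOdd i ∧ (i * i ≡ᵇ x)) ≡ (c ≡ᵇ i)
    only-c i _ = bool-ext
      (λ hit → ≡ᵇ-true (square-injective c i (trans sq≡x (sym (≡ᵇ-sound _ _ (proj₂ (∧-true {isOdd i} hit)))))))
      (λ c≡i → subst (λ z → (isOdd z ∧ (z * z ≡ᵇ x)) ≡ true) (≡ᵇ-sound c i c≡i)
                 (trans (cong (_∧ (c * c ≡ᵇ x)) (isOdd-suc-double m)) (≡ᵇ-true sq≡x)))
  from : ∑ N (λ a → isOdd a ∧ (a * a ≡ᵇ x)) ≡ true → Δ x ≡ true
  from hit with ∑-true⇒ N _ hit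
  ... | i , _ , hitᵢ with ∧-true {isOdd i} hitᵢ
  ...   | odd , sq with isOdd⇒ i odd
  ...     | m , refl = Δ-odd-square x m (≡ᵇ-sound _ _ sq)

3*-≡ᵇ : ∀ u v → (3 * u ≡ᵇ 3 * v) ≡ (u ≡ᵇ v)
3*-≡ᵇ u v = bool-ext (λ eq → ≡ᵇ-true (*-cancelˡ-≡ u v 3 (≡ᵇ-sound (3 * u) (3 * v) eq)))
                     (λ eq → ≡ᵇ-true (cong (3 *_) (≡ᵇ-sound u v eq)))

3*≢r+3* : ∀ u r s → 0 < r → r < 3 → 3 * u ≢ r + 3 * s
3*≢r+3* u r s 0<r r<3 eq = <⇒≢ 0<r (begin
  0                  ≡⟨ m*n%n≡0 u 3 ⟨
  (u * 3) % 3        ≡⟨ cong (_% 3) (trans (*-comm u 3) eq) ⟩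
  (r + 3 * s) % 3    ≡⟨ cong (λ z → (r + z) % 3) (*-comm 3 s) ⟩
  (r + s * 3) % 3    ≡⟨ [m+kn]%n≡m%n r s 3 ⟩
  r % 3              ≡⟨ m<n⇒m%n≡m r<3 ⟩
  r                  ∎)
  where open ≡-Reasoning

V₃Δ≡∑ : ∀ N t → t < N → V₃ Δ t ≡ ∑ N (λ b → isOdd b ∧ (3 * (b * b) ≡ᵇ t))
V₃Δ≡∑ N t t<N with residue3 t
... | rem0 s = begin
  V₃ Δ (3 * s)                                 ≡⟨ V₃-rem0 Δ s ⟩
  Δ s                                          ≡⟨ Δ≡∑ N s (≤-<-trans (m≤n*m s 3) t<N) ⟩
  ∑ N (λ b → isOdd b ∧ (b * b ≡ᵇ s))           ≡⟨ ∑-cong N (λ b → cong (isOdd b ∧_) (3*-≡ᵇ (b * b) s)) ⟨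
  ∑ N (λ b → isOdd b ∧ (3 * (b * b) ≡ᵇ 3 * s)) ∎
  where open ≡-Reasoning
... | rem1 s = trans (V₃-rem1 Δ s) (sym (∑-false N (λ b _ →
                 trans (cong (isOdd b ∧_) (≡ᵇ-false (3*≢r+3* (b * b) 1 s (s≤s z≤n) (s≤s (s≤s z≤n))))) (∧-zeroʳ _))))
... | rem2 s = trans (V₃-rem2 Δ s) (sym (∑-false N (λ b _ →
                 trans (cong (isOdd b ∧_) (≡ᵇ-false (3*≢r+3* (b * b) 2 s (s≤s z≤n) ≤-refl))) (∧-zeroʳ _))))

norm : ℕ → ℕ → ℕ
norm a b = a * a + 3 * (b * b)

Rep : ℕ → ℕ → ℕ → Bool
Rep n a b = isOdd a ∧ isOdd b ∧ (norm a b ≡ᵇ n)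

<ᵇ∧≡ᵇ∸ : ∀ n u v → ((u <ᵇ suc n) ∧ (v ≡ᵇ n ∸ u)) ≡ (u + v ≡ᵇ n)
<ᵇ∧≡ᵇ∸ n u v = bool-ext to from
  where
  to : ((u <ᵇ suc n) ∧ (v ≡ᵇ n ∸ u)) ≡ true → (u + v ≡ᵇ n) ≡ true
  to hyp with ∧-true {u <ᵇ suc n} hyp
  ... | u≤n , v≡n∸u = ≡ᵇ-true (trans (cong (u +_) (≡ᵇ-sound v (n ∸ u) v≡n∸u)) (m+[n∸m]≡n (≤-pred (<ᵇ-sound u (suc n) u≤n))))
  from : (u + v ≡ᵇ n) ≡ true → ((u <ᵇ suc n) ∧ (v ≡ᵇ n ∸ u)) ≡ true
  from u+v≡n = subst (λ k → ((u <ᵇ suc k) ∧ (v ≡ᵇ k ∸ u)) ≡ true) (≡ᵇ-sound (u + v) n u+v≡n)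
                     (cong₂ _∧_ (<ᵇ-true (s≤s (m≤m+n u v))) (≡ᵇ-true (sym (m+n∸m≡n u v))))

ΔV₃Δ≡∑Rep : ∀ n → mulS Δ (V₃ Δ) n ≡ ∑ (suc n) (λ a → ∑ (suc n) (λ b → Rep n a b))
ΔV₃Δ≡∑Rep n = begin
  mulS Δ (V₃ Δ) n
    ≡⟨ mulS-∑ Δ (V₃ Δ) n ⟩
  ∑ N (λ i → Δ i ∧ V₃ Δ (n ∸ i))
    ≡⟨ ∑-cong< N (λ i i<N → cong₂ _∧_ (Δ≡∑ N i i<N) (V₃Δ≡∑ N (n ∸ i) (s≤s (m∸n≤m n i)))) ⟩
  ∑ N (λ i → ∑ N (λ a → isOdd a ∧ (a * a ≡ᵇ i)) ∧ ∑ N (λ b → isOdd b ∧ (3 * (b * b) ≡ᵇ n ∸ i)))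
    ≡⟨ ∑-cong N (λ i → trans (∧-distribʳ-∑ N _ _) (∑-cong N (λ a → ∧-distribˡ-∑ N _ _))) ⟩
  ∑ N (λ i → ∑ N (λ a → ∑ N (λ b → Term i a b)))
    ≡⟨ ∑-swap N N _ ⟩
  ∑ N (λ a → ∑ N (λ i → ∑ N (λ b → Term i a b)))
    ≡⟨ ∑-cong N (λ a → ∑-swap N N _) ⟩
  ∑ N (λ a → ∑ N (λ b → ∑ N (λ i → Term i a b)))
    ≡⟨ ∑-cong N (λ a → ∑-cong N (λ b → trans (∑-cong N (λ i → regroup i a b)) (∑-indicator N (a * a) _))) ⟩
  ∑ N (λ a → ∑ N (λ b → (a * a <ᵇ N) ∧ (isOdd a ∧ isOdd b ∧ (3 * (b * b) ≡ᵇ n ∸ a * a))))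
    ≡⟨ ∑-cong N (λ a → ∑-cong N (λ b → Rep≡ a b)) ⟩
  ∑ N (λ a → ∑ N (λ b → Rep n a b)) ∎
  where
  open ≡-Reasoning
  N : ℕ
  N = suc n
  Term : ℕ → ℕ → ℕ → Bool
  Term i a b = (isOdd a ∧ (a * a ≡ᵇ i)) ∧ (isOdd b ∧ (3 * (b * b) ≡ᵇ n ∸ i))
  regroup : ∀ i a b → Term i a b ≡ ((a * a ≡ᵇ i) ∧ (isOdd a ∧ isOdd b ∧ (3 * (b * b) ≡ᵇ n ∸ i)))
  regroup i a b = rearrange (isOdd a) (isOdd b) (a * a ≡ᵇ i) (3 * (b * b) ≡ᵇ n ∸ i)
    where
    rearrange : ∀ p q r s → (p ∧ r) ∧ (q ∧ s) ≡ r ∧ (p ∧ q ∧ s)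
    rearrange true  q r s = refl
    rearrange false q r s = sym (∧-zeroʳ r)
  Rep≡ : ∀ a b → ((a * a <ᵇ N) ∧ (isOdd a ∧ isOdd b ∧ (3 * (b * b) ≡ᵇ n ∸ a * a))) ≡ Rep n a b
  Rep≡ a b with isOdd a | isOdd b
  ... | true  | true  = <ᵇ∧≡ᵇ∸ n (a * a) (3 * (b * b))
  ... | true  | false = ∧-zeroʳ _
  ... | false | _     = ∧-zeroʳ _

isOdd-+ : ∀ x y → isOdd (x + y) ≡ isOdd x xor isOdd y
isOdd-+ zero y = refl
isOdd-+ (suc zero) y = isOdd-suc y
  where
  isOdd-suc : ∀ y → isOdd (suc y) ≡ not (isOdd y)
  isOdd-suc zero = refl
  isOdd-suc (suc zero) = refl
  isOdd-suc (suc (suc y)) = isOdd-suc y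
isOdd-+ (suc (suc x)) y = isOdd-+ x y

2*≡+ : ∀ n → 2 * n ≡ n + n
2*≡+ n = cong (n +_) (+-identityʳ n)

isOdd-2*+ : ∀ b c → isOdd (2 * b + c) ≡ isOdd c
isOdd-2*+ b c = trans (cong (λ z → isOdd (z + c)) (2*≡+ b)) (trans (isOdd-+ (b + b) c) (cong (_xor isOdd c) (isOdd-double b)))

isOdd-3* : ∀ b → isOdd (3 * b) ≡ isOdd b
isOdd-3* b = trans (cong isOdd (3*≡ b)) (isOdd-2*+ b b)
  where
  3*≡ : ∀ b → 3 * b ≡ 2 * b + b
  3*≡ = solve-∀

odd-summand : ∀ x y → isOdd x ≡ true → isOdd (x + y) ≡ false → isOdd y ≡ true
odd-summand x y odd-x even-sum with isOdd y in odd-y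
... | true = refl
... | false with trans (sym even-sum) (trans (isOdd-+ x y) (cong₂ _xor_ odd-x odd-y))
...   | ()

odd⇒pos : ∀ x → isOdd x ≡ true → 0 < x
odd⇒pos (suc x) _ = s≤s z≤n

half-double : ∀ {x} n → x ≡ n + n → ⌊ x /2⌋ ≡ n
half-double n refl = sym (n≡⌊n+n/2⌋ n)

double-injective : ∀ x y → x + x ≡ y + y → x ≡ y
double-injective x y eq = trans (n≡⌊n+n/2⌋ x) (half-double y eq)

odd+odd≡double : ∀ a b → isOdd a ≡ true → isOdd b ≡ true → a + b ≡ ⌊ a + b /2⌋ + ⌊ a + b /2⌋
odd+odd≡double a b odd-a odd-b with isOdd⇒ a odd-a | isOdd⇒ b odd-b
... | m , refl | j , refl = trans (regroup m j) (cong (λ z → z + z) (sym (half-double (suc (m + j)) (regroup m j))))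
  where
  regroup : ∀ m j → suc (m + m) + suc (j + j) ≡ suc (m + j) + suc (m + j)
  regroup = solve-∀

odd-gap : ∀ {x y} → isOdd x ≡ true → isOdd y ≡ true → y ≤ x → Σ ℕ (λ c → x ≡ y + 2 * c)
odd-gap {x} {y} odd-x odd-y y≤x with parity (x ∸ y)
... | c , inj₁ gap≡ = c , trans (sym (m+[n∸m]≡n y≤x)) (cong (y +_) (trans gap≡ (sym (2*≡+ c))))
... | c , inj₂ gap≡ with trans (sym odd-x) (trans (cong isOdd (sym (m+[n∸m]≡n y≤x)))
                             (trans (isOdd-+ y (x ∸ y)) (cong₂ _xor_ odd-y (trans (cong isOdd gap≡) (isOdd-suc-double c)))))
...   | ()

∣m+n-m∣≡n : ∀ m n → ∣ m + n - m ∣ ≡ n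
∣m+n-m∣≡n m n = trans (∣-∣-comm (m + n) m) (∣m-m+n∣≡n m n)

-- Multiplying a + b√−3 by the unit (1 ± √−3)/2 gives ((a ∓ 3b) + (b ± a)√−3)/2. For odd a, b both
-- coordinates are odd for exactly one sign (+ iff (a + b)/2 is odd); φ takes that one up to signs,
-- so it preserves a² + 3b², and the conjugate unit undoes it, so φ is an involution.
φ : ℕ → ℕ → ℕ × ℕ
φ a b = if isOdd ⌊ a + b /2⌋
        then (⌊ ∣ a - 3 * b ∣ /2⌋ , ⌊ a + b /2⌋)
        else (⌊ a + 3 * b /2⌋ , ⌊ ∣ a - b ∣ /2⌋)

φ₁ φ₂ : ℕ → ℕ → ℕ
φ₁ a b = proj₁ (φ a b)
φ₂ a b = proj₂ (φ a b)

φ-odd : ∀ a b → isOdd ⌊ a + b /2⌋ ≡ true → φ a b ≡ (⌊ ∣ a - 3 * b ∣ /2⌋ , ⌊ a + b /2⌋)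
φ-odd a b odd rewrite odd = refl

φ-even : ∀ a b → isOdd ⌊ a + b /2⌋ ≡ false → φ a b ≡ (⌊ a + 3 * b /2⌋ , ⌊ ∣ a - b ∣ /2⌋)
φ-even a b even rewrite even = refl

half-∣m+n-m∣ : ∀ m n → ⌊ ∣ m + 2 * n - m ∣ /2⌋ ≡ n
half-∣m+n-m∣ m n = trans (cong ⌊_/2⌋ (∣m+n-m∣≡n m (2 * n))) (half-double n (2*≡+ n))

half-∣m-m+n∣ : ∀ m n → ⌊ ∣ m - m + 2 * n ∣ /2⌋ ≡ n
half-∣m-m+n∣ m n = trans (cong ⌊_/2⌋ (∣m-m+n∣≡n m (2 * n))) (half-double n (2*≡+ n))

φ-a≡3b+2c : ∀ b c → isOdd c ≡ true → φ (3 * b + 2 * c) b ≡ (c , 2 * b + c)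
φ-a≡3b+2c b c odd-c =
  trans (φ-odd (3 * b + 2 * c) b (trans (cong isOdd s≡) (trans (isOdd-2*+ b c) odd-c)))
        (cong₂ _,_ (half-∣m+n-m∣ (3 * b) c) s≡)
  where
  regroup : ∀ b c → 3 * b + 2 * c + b ≡ (2 * b + c) + (2 * b + c)
  regroup = solve-∀
  s≡ : ⌊ 3 * b + 2 * c + b /2⌋ ≡ 2 * b + c
  s≡ = half-double (2 * b + c) (regroup b c)

φ-3b≡a+2e : ∀ a b e s → isOdd s ≡ true → 3 * b ≡ a + 2 * e → a + b ≡ s + s → φ a b ≡ (e , s)
φ-3b≡a+2e a b e s odd-s 3b≡ a+b≡ =
  trans (φ-odd a b (trans (cong isOdd s≡) odd-s)) (cong₂ _,_ (trans (cong (λ z → ⌊ ∣ a - z ∣ /2⌋) 3b≡) (half-∣m-m+n∣ a e)) s≡)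
  where
  s≡ : ⌊ a + b /2⌋ ≡ s
  s≡ = half-double s a+b≡

φ-a≡b+2d : ∀ b d → isOdd b ≡ true → isOdd d ≡ true → φ (b + 2 * d) b ≡ (d + 2 * b , d)
φ-a≡b+2d b d odd-b odd-d =
  trans (φ-even (b + 2 * d) b s-even) (cong₂ _,_ (half-double (d + 2 * b) (regroup₂ b d)) (half-∣m+n-m∣ b d))
  where
  regroup₁ : ∀ b d → b + 2 * d + b ≡ (b + d) + (b + d)
  regroup₁ = solve-∀
  regroup₂ : ∀ b d → b + 2 * d + 3 * b ≡ (d + 2 * b) + (d + 2 * b)
  regroup₂ = solve-∀
  s-even : isOdd ⌊ b + 2 * d + b /2⌋ ≡ false
  s-even = trans (cong isOdd (half-double (b + d) (regroup₁ b d))) (trans (isOdd-+ b d) (cong₂ _xor_ odd-b odd-d))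

φ-b≡a+2e : ∀ a e → isOdd a ≡ true → isOdd e ≡ true → φ a (a + 2 * e) ≡ (2 * a + 3 * e , e)
φ-b≡a+2e a e odd-a odd-e =
  trans (φ-even a (a + 2 * e) s-even) (cong₂ _,_ (half-double (2 * a + 3 * e) (regroup₂ a e)) (half-∣m-m+n∣ a e))
  where
  regroup₁ : ∀ a e → a + (a + 2 * e) ≡ (a + e) + (a + e)
  regroup₁ = solve-∀
  regroup₂ : ∀ a e → a + 3 * (a + 2 * e) ≡ (2 * a + 3 * e) + (2 * a + 3 * e)
  regroup₂ = solve-∀
  s-even : isOdd ⌊ a + (a + 2 * e) /2⌋ ≡ false
  s-even = trans (cong isOdd (half-double (a + e) (regroup₁ a e))) (trans (isOdd-+ a e) (cong₂ _xor_ odd-a odd-e))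

data Sector (a b : ℕ) : Set where
  a≡3b+2c : ∀ c → isOdd c ≡ true → a ≡ 3 * b + 2 * c → Sector a b
  3b≡a+2e : ∀ e s → isOdd e ≡ true → isOdd s ≡ true → 3 * b ≡ a + 2 * e → a + b ≡ s + s → Sector a b
  a≡b+2d : ∀ d → isOdd d ≡ true → a ≡ b + 2 * d → Sector a b
  b≡a+2e : ∀ e → isOdd e ≡ true → b ≡ a + 2 * e → Sector a b

3b≡a+2e⇒2b≡s+e : ∀ a b e s → 3 * b ≡ a + 2 * e → a + b ≡ s + s → b + b ≡ s + e
3b≡a+2e⇒2b≡s+e a b e s 3b≡ a+b≡ = double-injective (b + b) (s + e) (begin
  (b + b) + (b + b)   ≡⟨ l₁ b ⟩
  3 * b + b           ≡⟨ cong (_+ b) 3b≡ ⟩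
  a + 2 * e + b       ≡⟨ l₂ a e b ⟩
  (a + b) + 2 * e     ≡⟨ cong (_+ 2 * e) a+b≡ ⟩
  (s + s) + 2 * e     ≡⟨ l₃ s e ⟩
  (s + e) + (s + e)   ∎)
  where
  open ≡-Reasoning
  l₁ : ∀ b → (b + b) + (b + b) ≡ 3 * b + b
  l₁ = solve-∀
  l₂ : ∀ a e b → a + 2 * e + b ≡ (a + b) + 2 * e
  l₂ = solve-∀
  l₃ : ∀ s e → (s + s) + 2 * e ≡ (s + e) + (s + e)
  l₃ = solve-∀

sector-odd : ∀ a b s → isOdd a ≡ true → isOdd b ≡ true → isOdd s ≡ true → a + b ≡ s + s → Sector a b
sector-odd a b s odd-a odd-b odd-s a+b≡ with ≤-total (3 * b) a
... | inj₁ 3b≤a with odd-gap odd-a (trans (isOdd-3* b) odd-b) 3b≤a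
...   | c , refl = a≡3b+2c c odd-c refl
  where
  regroup : ∀ b c → 3 * b + 2 * c + b ≡ (2 * b + c) + (2 * b + c)
  regroup = solve-∀
  odd-c : isOdd c ≡ true
  odd-c = trans (sym (isOdd-2*+ b c)) (trans (cong isOdd (double-injective (2 * b + c) s (trans (sym (regroup b c)) a+b≡))) odd-s)
sector-odd a b s odd-a odd-b odd-s a+b≡ | inj₂ a≤3b with odd-gap (trans (isOdd-3* b) odd-b) odd-a a≤3b
... | e , 3b≡ = 3b≡a+2e e s odd-e odd-s 3b≡ a+b≡
  where
  odd-e : isOdd e ≡ true
  odd-e = odd-summand s e odd-s (trans (cong isOdd (sym (3b≡a+2e⇒2b≡s+e a b e s 3b≡ a+b≡))) (isOdd-double b))

sector-even : ∀ a b s → isOdd a ≡ true → isOdd b ≡ true → isOdd s ≡ false → a + b ≡ s + s → Sector a b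
sector-even a b s odd-a odd-b even-s a+b≡ with ≤-total b a
... | inj₁ b≤a with odd-gap odd-a odd-b b≤a
...   | d , refl = a≡b+2d d (odd-summand b d odd-b (trans (cong isOdd s≡) even-s)) refl
  where
  regroup : ∀ b d → b + 2 * d + b ≡ (b + d) + (b + d)
  regroup = solve-∀
  s≡ : b + d ≡ s
  s≡ = double-injective (b + d) s (trans (sym (regroup b d)) a+b≡)
sector-even a b s odd-a odd-b even-s a+b≡ | inj₂ a≤b with odd-gap odd-b odd-a a≤b
... | e , refl = b≡a+2e e (odd-summand a e odd-a (trans (cong isOdd s≡) even-s)) refl
  where
  regroup : ∀ a e → a + (a + 2 * e) ≡ (a + e) + (a + e)
  regroup = solve-∀
  s≡ : a + e ≡ s
  s≡ = double-injective (a + e) s (trans (sym (regroup a e)) a+b≡)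

sector : ∀ a b → isOdd a ≡ true → isOdd b ≡ true → Sector a b
sector a b odd-a odd-b with isOdd ⌊ a + b /2⌋ in parity-s
... | true  = sector-odd a b ⌊ a + b /2⌋ odd-a odd-b parity-s (odd+odd≡double a b odd-a odd-b)
... | false = sector-even a b ⌊ a + b /2⌋ odd-a odd-b parity-s (odd+odd≡double a b odd-a odd-b)

3b≡a+2e⇒3s≡e+2a : ∀ a b e s → 3 * b ≡ a + 2 * e → a + b ≡ s + s → 3 * s ≡ e + 2 * a
3b≡a+2e⇒3s≡e+2a a b e s 3b≡ a+b≡ = +-cancelʳ-≡ s (3 * s) (e + 2 * a) (begin
  3 * s + s          ≡⟨ l₁ s ⟩
  (s + s) + (s + s)  ≡⟨ cong₂ _+_ a+b≡ a+b≡ ⟨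
  (a + b) + (a + b)  ≡⟨ l₂ a b ⟩
  (b + b) + 2 * a    ≡⟨ cong (_+ 2 * a) (3b≡a+2e⇒2b≡s+e a b e s 3b≡ a+b≡) ⟩
  (s + e) + 2 * a    ≡⟨ l₃ s e a ⟩
  e + 2 * a + s      ∎)
  where
  open ≡-Reasoning
  l₁ : ∀ s → 3 * s + s ≡ (s + s) + (s + s)
  l₁ = solve-∀
  l₂ : ∀ a b → (a + b) + (a + b) ≡ (b + b) + 2 * a
  l₂ = solve-∀
  l₃ : ∀ s e a → (s + e) + 2 * a ≡ e + 2 * a + s
  l₃ = solve-∀

φ-involutive : ∀ a b → isOdd a ≡ true → isOdd b ≡ true → φ (φ₁ a b) (φ₂ a b) ≡ (a , b)
φ-involutive a b odd-a odd-b with sector a b odd-a odd-b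
... | a≡3b+2c c odd-c refl rewrite φ-a≡3b+2c b c odd-c | +-comm (2 * b) c | φ-b≡a+2e c b odd-c odd-b
                                 | +-comm (2 * c) (3 * b) = refl
... | b≡a+2e e odd-e refl rewrite φ-b≡a+2e a e odd-a odd-e | +-comm (2 * a) (3 * e) | φ-a≡3b+2c e a odd-a
                                 | +-comm (2 * e) a = refl
... | a≡b+2d d odd-d refl rewrite φ-a≡b+2d b d odd-b odd-d | φ-a≡b+2d d b odd-d odd-b = refl
... | 3b≡a+2e e s odd-e odd-s 3b≡ a+b≡ rewrite φ-3b≡a+2e a b e s odd-s 3b≡ a+b≡ =
  φ-3b≡a+2e e s a b odd-b (3b≡a+2e⇒3s≡e+2a a b e s 3b≡ a+b≡) (trans (+-comm e s) (sym (3b≡a+2e⇒2b≡s+e a b e s 3b≡ a+b≡)))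

≡ᵇ-false-< : ∀ {m n} → m < n → (n ≡ᵇ m) ≡ false
≡ᵇ-false-< m<n = ≡ᵇ-false (λ n≡m → <⇒≢ m<n (sym n≡m))

b+2b≡3b : ∀ b → b + 2 * b ≡ 3 * b
b+2b≡3b = solve-∀

odd<m+2*odd : ∀ m t → isOdd t ≡ true → t < m + 2 * t
odd<m+2*odd m t odd-t = <-≤-trans (m<m+n t (odd⇒pos t odd-t)) (≤-trans (≤-reflexive (sym (2*≡+ t))) (m≤n+m (2 * t) m))

m<m+2*odd : ∀ m t → isOdd t ≡ true → m < m + 2 * t
m<m+2*odd m t odd-t = m<m+n m (≤-trans (odd⇒pos t odd-t) (m≤m+n t (t + 0)))

φ-fixed : ∀ a b → isOdd a ≡ true → isOdd b ≡ true →
          ((φ₁ a b ≡ᵇ a) ∧ (φ₂ a b ≡ᵇ b)) ≡ ((a ≡ᵇ b) xor (a ≡ᵇ 3 * b))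
φ-fixed a b odd-a odd-b with sector a b odd-a odd-b
... | a≡3b+2c c odd-c refl rewrite φ-a≡3b+2c b c odd-c
  | ≡ᵇ-false-< (<-≤-trans (odd<m+2*odd 0 b odd-b) (m≤m+n (2 * b) c))
  | ≡ᵇ-false-< (<-≤-trans (odd<m+2*odd b b odd-b) (≤-trans (≤-reflexive (b+2b≡3b b)) (m≤m+n (3 * b) (2 * c))))
  | ≡ᵇ-false-< (m<m+2*odd (3 * b) c odd-c) = ∧-zeroʳ _
... | b≡a+2e e odd-e refl rewrite φ-b≡a+2e a e odd-a odd-e
  | ≡ᵇ-false (<⇒≢ (odd<m+2*odd a e odd-e))
  | ≡ᵇ-false (<⇒≢ (m<m+2*odd a e odd-e))
  | ≡ᵇ-false (<⇒≢ (<-≤-trans (m<m+2*odd a e odd-e) (m≤n*m (a + 2 * e) 3))) = ∧-zeroʳ _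
... | a≡b+2d d odd-d refl rewrite φ-a≡b+2d b d odd-b odd-d | ≡ᵇ-false-< (m<m+2*odd b d odd-d) with d ≟ b
...   | yes refl rewrite ≡ᵇ-true {b} refl | ≡ᵇ-true (b+2b≡3b b) = refl
...   | no d≢b rewrite ≡ᵇ-false d≢b
  | ≡ᵇ-false (λ b+2d≡3b → d≢b (*-cancelˡ-≡ d b 2 (+-cancelˡ-≡ b (2 * d) (2 * b) (trans b+2d≡3b (sym (b+2b≡3b b)))))) =
  ∧-zeroʳ _
φ-fixed a b odd-a odd-b | 3b≡a+2e e s odd-e odd-s 3b≡ a+b≡ rewrite φ-3b≡a+2e a b e s odd-s 3b≡ a+b≡
  | ≡ᵇ-false (λ a≡3b → <⇒≢ (m<m+2*odd a e odd-e) (trans a≡3b 3b≡)) with a ≟ b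
... | yes refl = trans (cong₂ _∧_ (≡ᵇ-true e≡a) (≡ᵇ-true s≡a)) (sym (cong (_xor false) (≡ᵇ-true {a} refl)))
  where
  s≡a : s ≡ a
  s≡a = sym (double-injective a s a+b≡)
  e≡a : e ≡ a
  e≡a = sym (+-cancelˡ-≡ a a e (trans (3b≡a+2e⇒2b≡s+e a a e s 3b≡ a+b≡) (cong (_+ e) s≡a)))
... | no a≢b rewrite ≡ᵇ-false a≢b | ≡ᵇ-false {s} {b} (λ s≡b → a≢b (+-cancelʳ-≡ b a b (trans a+b≡ (cong₂ _+_ s≡b s≡b)))) =
  ∧-zeroʳ _

3b≡a+2e⇒norm : ∀ a b e s → 3 * b ≡ a + 2 * e → a + b ≡ s + s → norm e s ≡ norm a b
3b≡a+2e⇒norm a b e s 3b≡ a+b≡ = *-cancelˡ-≡ (norm e s) (norm a b) 4 (begin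
  4 * norm e s                                   ≡⟨ l₁ e s ⟨
  (2 * e) * (2 * e) + 3 * ((s + s) * (s + s))    ≡⟨ cong (λ z → (2 * e) * (2 * e) + 3 * (z * z)) a+b≡ ⟨
  (2 * e) * (2 * e) + 3 * ((a + b) * (a + b))    ≡⟨ +-cancelʳ-≡ (2 * a * (3 * b)) _ _ shifted ⟩
  4 * norm a b                                   ∎)
  where
  open ≡-Reasoning
  l₁ : ∀ e s → (2 * e) * (2 * e) + 3 * ((s + s) * (s + s)) ≡ 4 * (e * e + 3 * (s * s))
  l₁ = solve-∀
  l₂ : ∀ e a b → (2 * e) * (2 * e) + 3 * ((a + b) * (a + b)) + 2 * a * (2 * e + a)
               ≡ (2 * e + a) * (2 * e + a) + a * a + 3 * ((a + b) * (a + b))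
  l₂ = solve-∀
  l₃ : ∀ a b → (3 * b) * (3 * b) + a * a + 3 * ((a + b) * (a + b)) ≡ 4 * (a * a + 3 * (b * b)) + 2 * a * (3 * b)
  l₃ = solve-∀
  2e+a≡3b : 2 * e + a ≡ 3 * b
  2e+a≡3b = trans (+-comm (2 * e) a) (sym 3b≡)
  shifted : (2 * e) * (2 * e) + 3 * ((a + b) * (a + b)) + 2 * a * (3 * b) ≡ 4 * norm a b + 2 * a * (3 * b)
  shifted = begin
    (2 * e) * (2 * e) + 3 * ((a + b) * (a + b)) + 2 * a * (3 * b)
      ≡⟨ cong (λ z → (2 * e) * (2 * e) + 3 * ((a + b) * (a + b)) + 2 * a * z) 2e+a≡3b ⟨
    (2 * e) * (2 * e) + 3 * ((a + b) * (a + b)) + 2 * a * (2 * e + a)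
      ≡⟨ l₂ e a b ⟩
    (2 * e + a) * (2 * e + a) + a * a + 3 * ((a + b) * (a + b))
      ≡⟨ cong (λ z → z * z + a * a + 3 * ((a + b) * (a + b))) 2e+a≡3b ⟩
    (3 * b) * (3 * b) + a * a + 3 * ((a + b) * (a + b))
      ≡⟨ l₃ a b ⟩
    4 * norm a b + 2 * a * (3 * b) ∎

φ-preserves : ∀ a b → isOdd a ≡ true → isOdd b ≡ true →
              (isOdd (φ₁ a b) ≡ true × isOdd (φ₂ a b) ≡ true) × norm (φ₁ a b) (φ₂ a b) ≡ norm a b
φ-preserves a b odd-a odd-b with sector a b odd-a odd-b
... | a≡3b+2c c odd-c refl rewrite φ-a≡3b+2c b c odd-c =
  (odd-c , trans (isOdd-2*+ b c) odd-c) , identity b c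
  where
  identity : ∀ b c → c * c + 3 * ((2 * b + c) * (2 * b + c)) ≡ (3 * b + 2 * c) * (3 * b + 2 * c) + 3 * (b * b)
  identity = solve-∀
... | b≡a+2e e odd-e refl rewrite φ-b≡a+2e a e odd-a odd-e =
  (trans (isOdd-2*+ a (3 * e)) (trans (isOdd-3* e) odd-e) , odd-e) , identity a e
  where
  identity : ∀ a e → (2 * a + 3 * e) * (2 * a + 3 * e) + 3 * (e * e) ≡ a * a + 3 * ((a + 2 * e) * (a + 2 * e))
  identity = solve-∀
... | a≡b+2d d odd-d refl rewrite φ-a≡b+2d b d odd-b odd-d =
  (trans (cong isOdd (+-comm d (2 * b))) (trans (isOdd-2*+ b d) odd-d) , odd-d) , identity b d
  where
  identity : ∀ b d → (d + 2 * b) * (d + 2 * b) + 3 * (d * d) ≡ (b + 2 * d) * (b + 2 * d) + 3 * (b * b)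
  identity = solve-∀
... | 3b≡a+2e e s odd-e odd-s 3b≡ a+b≡ rewrite φ-3b≡a+2e a b e s odd-s 3b≡ a+b≡ =
  (odd-e , odd-s) , 3b≡a+2e⇒norm a b e s 3b≡ a+b≡

∑-flatten : ∀ A N (G : ℕ → Bool) → ∑ (A * N) G ≡ ∑ A (λ a → ∑ N (λ b → G (b + a * N)))
∑-flatten zero N G = refl
∑-flatten (suc A) N G = begin
  ∑ (N + A * N) G
    ≡⟨ ∑-+ N (A * N) G ⟩
  ∑ N G xor ∑ (A * N) (λ i → G (N + i))
    ≡⟨ cong₂ _xor_ (∑-cong N (λ b → cong G (sym (+-identityʳ b)))) (∑-flatten A N (λ i → G (N + i))) ⟩
  ∑ N (λ b → G (b + 0)) xor ∑ A (λ a → ∑ N (λ b → G (N + (b + a * N))))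
    ≡⟨ cong (∑ N (λ b → G (b + 0)) xor_) (∑-cong A (λ a → ∑-cong N (λ b → cong G (shift a b)))) ⟩
  ∑ N (λ b → G (b + 0 * N)) xor ∑ A (λ a → ∑ N (λ b → G (b + suc a * N)))
    ≡⟨ ∑-head A _ ⟨
  ∑ (suc A) (λ a → ∑ N (λ b → G (b + a * N))) ∎
  where
  open ≡-Reasoning
  shift : ∀ a b → N + (b + a * N) ≡ b + suc a * N
  shift a b = trans (sym (+-assoc N b (a * N))) (trans (cong (_+ a * N) (+-comm N b)) (+-assoc b N (a * N)))

module Pairing (N : ℕ) .{{_ : NonZero N}} where

  pair : ℕ → ℕ → ℕ
  pair a b = b + a * N

  pair-% : ∀ a b → b < N → pair a b % N ≡ b
  pair-% a b b<N = trans ([m+kn]%n≡m%n b a N) (m<n⇒m%n≡m b<N)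

  pair-/ : ∀ a b → b < N → pair a b / N ≡ a
  pair-/ a b b<N = trans (+-distrib-/-∣ʳ b (n∣m*n a)) (cong₂ _+_ (m<n⇒m/n≡0 b<N) (m*n/n≡m a N))

  pair-/-% : ∀ x → pair (x / N) (x % N) ≡ x
  pair-/-% x = sym (m≡m%n+[m/n]*n x N)

  pair-< : ∀ a b → a < N → b < N → pair a b < N * N
  pair-< a b a<N b<N = ≤-trans (+-monoˡ-< (a * N) b<N) (*-monoˡ-≤ N a<N)

  pair-≡ᵇ : ∀ a b a′ b′ → b < N → b′ < N → (pair a′ b′ ≡ᵇ pair a b) ≡ ((a′ ≡ᵇ a) ∧ (b′ ≡ᵇ b))
  pair-≡ᵇ a b a′ b′ b<N b′<N = bool-ext to from
    where
    to : (pair a′ b′ ≡ᵇ pair a b) ≡ true → ((a′ ≡ᵇ a) ∧ (b′ ≡ᵇ b)) ≡ true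
    to eq = let e = ≡ᵇ-sound (pair a′ b′) (pair a b) eq in
      cong₂ _∧_ (≡ᵇ-true (trans (sym (pair-/ a′ b′ b′<N)) (trans (cong (_/ N) e) (pair-/ a b b<N))))
                (≡ᵇ-true (trans (sym (pair-% a′ b′ b′<N)) (trans (cong (_% N) e) (pair-% a b b<N))))
    from : ((a′ ≡ᵇ a) ∧ (b′ ≡ᵇ b)) ≡ true → (pair a′ b′ ≡ᵇ pair a b) ≡ true
    from eq = let (a′≡a , b′≡b) = ∧-true {a′ ≡ᵇ a} eq in
      ≡ᵇ-true (cong₂ pair (≡ᵇ-sound a′ a a′≡a) (≡ᵇ-sound b′ b b′≡b))

Rep⇒ : ∀ n a b → Rep n a b ≡ true → (isOdd a ≡ true × isOdd b ≡ true) × norm a b ≡ n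
Rep⇒ n a b rep with ∧-true {isOdd a} rep
... | odd-a , rest with ∧-true {isOdd b} rest
...   | odd-b , norm≡ = (odd-a , odd-b) , ≡ᵇ-sound _ n norm≡

Rep-bound : ∀ n a b → Rep n a b ≡ true → a < suc n × b < suc n
Rep-bound n a b rep with Rep⇒ n a b rep
... | _ , norm≡n = s≤s (≤-trans (n≤n*n a) (≤-trans (m≤m+n (a * a) _) (≤-reflexive norm≡n)))
                 , s≤s (≤-trans (n≤n*n b) (≤-trans (m≤n*m (b * b) 3) (≤-trans (m≤n+m _ (a * a)) (≤-reflexive norm≡n))))

Rep-φ : ∀ n a b → Rep n a b ≡ true → Rep n (φ₁ a b) (φ₂ a b) ≡ true
Rep-φ n a b rep with Rep⇒ n a b rep
... | (odd-a , odd-b) , norm≡n with φ-preserves a b odd-a odd-b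
...   | (odd₁ , odd₂) , norm≡ rewrite odd₁ | odd₂ = ≡ᵇ-true (trans norm≡ norm≡n)

∑Rep≡∑fixed : ∀ n → ∑ (suc n) (λ a → ∑ (suc n) (λ b → Rep n a b))
                  ≡ ∑ (suc n) (λ a → ∑ (suc n) (λ b → Rep n a b ∧ ((a ≡ᵇ b) xor (a ≡ᵇ 3 * b))))
∑Rep≡∑fixed n = begin
  ∑ N (λ a → ∑ N (λ b → Rep n a b))                       ≡⟨ ∑-cong N (λ a → ∑-cong< N (λ b b<N → F-pair a b b<N)) ⟨
  ∑ N (λ a → ∑ N (λ b → F (pair a b)))                    ≡⟨ ∑-flatten N N F ⟨
  ∑ (N * N) F                                             ≡⟨ ∑-fixed-points (N * N) F σ σ-maps F∘σ σσ≡id ⟩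
  ∑ (N * N) (λ x → F x ∧ (σ x ≡ᵇ x))                      ≡⟨ ∑-flatten N N _ ⟩
  ∑ N (λ a → ∑ N (λ b → F (pair a b) ∧ (σ (pair a b) ≡ᵇ pair a b)))
                                                          ≡⟨ ∑-cong N (λ a → ∑-cong< N (λ b b<N → fixed a b b<N)) ⟩
  ∑ N (λ a → ∑ N (λ b → Rep n a b ∧ ((a ≡ᵇ b) xor (a ≡ᵇ 3 * b)))) ∎
  where
  open ≡-Reasoning
  N : ℕ
  N = suc n
  open Pairing N
  F : ℕ → Bool
  F x = Rep n (x / N) (x % N)
  σ : ℕ → ℕ
  σ x = pair (φ₁ (x / N) (x % N)) (φ₂ (x / N) (x % N))
  F-pair : ∀ a b → b < N → F (pair a b) ≡ Rep n a b
  F-pair a b b<N = cong₂ (Rep n) (pair-/ a b b<N) (pair-% a b b<N)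
  σ-pair : ∀ a b → b < N → σ (pair a b) ≡ pair (φ₁ a b) (φ₂ a b)
  σ-pair a b b<N = cong₂ (λ u v → pair (φ₁ u v) (φ₂ u v)) (pair-/ a b b<N) (pair-% a b b<N)
  σ-maps : ∀ x → x < N * N → F x ≡ true → σ x < N * N
  σ-maps x _ Fx = let (a<N , b<N) = Rep-bound n (φ₁ (x / N) (x % N)) (φ₂ (x / N) (x % N)) (Rep-φ n (x / N) (x % N) Fx) in
    pair-< (φ₁ (x / N) (x % N)) (φ₂ (x / N) (x % N)) a<N b<N
  F∘σ : ∀ x → x < N * N → F x ≡ true → F (σ x) ≡ true
  F∘σ x _ Fx = let (_ , b<N) = Rep-bound n (φ₁ (x / N) (x % N)) (φ₂ (x / N) (x % N)) (Rep-φ n (x / N) (x % N) Fx) in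
    trans (F-pair (φ₁ (x / N) (x % N)) (φ₂ (x / N) (x % N)) b<N) (Rep-φ n (x / N) (x % N) Fx)
  σσ≡id : ∀ x → x < N * N → F x ≡ true → σ (σ x) ≡ x
  σσ≡id x _ Fx with Rep⇒ n (x / N) (x % N) Fx
  ... | (odd-a , odd-b) , _ = let (_ , b<N) = Rep-bound n (φ₁ (x / N) (x % N)) (φ₂ (x / N) (x % N)) (Rep-φ n (x / N) (x % N) Fx) in
    trans (σ-pair (φ₁ (x / N) (x % N)) (φ₂ (x / N) (x % N)) b<N)
          (trans (cong (λ p → pair (proj₁ p) (proj₂ p)) (φ-involutive (x / N) (x % N) odd-a odd-b)) (pair-/-% x))
  fixed : ∀ a b → b < N → (F (pair a b) ∧ (σ (pair a b) ≡ᵇ pair a b)) ≡ (Rep n a b ∧ ((a ≡ᵇ b) xor (a ≡ᵇ 3 * b)))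
  fixed a b b<N rewrite F-pair a b b<N | σ-pair a b b<N with Rep n a b in rep
  ... | false = refl
  ... | true with Rep⇒ n a b rep
  ...   | (odd-a , odd-b) , _ = let (_ , φ₂<N) = Rep-bound n (φ₁ a b) (φ₂ a b) (Rep-φ n a b rep) in
    trans (pair-≡ᵇ a b (φ₁ a b) (φ₂ a b) b<N φ₂<N) (φ-fixed a b odd-a odd-b)

≡ᵇ-sym : ∀ a c → (a ≡ᵇ c) ≡ (c ≡ᵇ a)
≡ᵇ-sym a c = bool-ext (λ eq → ≡ᵇ-true (sym (≡ᵇ-sound a c eq))) (λ eq → ≡ᵇ-true (sym (≡ᵇ-sound c a eq)))

∑fixed≡diagonals : ∀ n → ∑ (suc n) (λ a → ∑ (suc n) (λ b → Rep n a b ∧ ((a ≡ᵇ b) xor (a ≡ᵇ 3 * b))))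
                       ≡ ∑ (suc n) (λ a → Rep n a a) xor ∑ (suc n) (λ b → (3 * b <ᵇ suc n) ∧ Rep n (3 * b) b)
∑fixed≡diagonals n = begin
  ∑ N (λ a → ∑ N (λ b → Rep n a b ∧ ((a ≡ᵇ b) xor (a ≡ᵇ 3 * b))))
    ≡⟨ ∑-cong N (λ a → trans (∑-cong N (λ b → ∧-distribˡ-xor (Rep n a b) _ _)) (∑-xor N _ _)) ⟩
  ∑ N (λ a → ∑ N (λ b → Rep n a b ∧ (a ≡ᵇ b)) xor ∑ N (λ b → Rep n a b ∧ (a ≡ᵇ 3 * b)))
    ≡⟨ ∑-xor N _ _ ⟩
  ∑ N (λ a → ∑ N (λ b → Rep n a b ∧ (a ≡ᵇ b))) xor ∑ N (λ a → ∑ N (λ b → Rep n a b ∧ (a ≡ᵇ 3 * b)))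
    ≡⟨ cong₂ _xor_ a≡b a≡3b ⟩
  ∑ N (λ a → Rep n a a) xor ∑ N (λ b → (3 * b <ᵇ N) ∧ Rep n (3 * b) b) ∎
  where
  open ≡-Reasoning
  N : ℕ
  N = suc n
  a≡b : ∑ N (λ a → ∑ N (λ b → Rep n a b ∧ (a ≡ᵇ b))) ≡ ∑ N (λ a → Rep n a a)
  a≡b = ∑-cong< N (λ a a<N → trans (∑-cong N (λ b → ∧-comm (Rep n a b) _))
                                   (trans (∑-indicator N a (Rep n a)) (cong (_∧ Rep n a a) (<ᵇ-true a<N))))
  a≡3b : ∑ N (λ a → ∑ N (λ b → Rep n a b ∧ (a ≡ᵇ 3 * b))) ≡ ∑ N (λ b → (3 * b <ᵇ N) ∧ Rep n (3 * b) b)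
  a≡3b = trans (∑-swap N N _) (∑-cong N (λ b →
           trans (∑-cong N (λ a → trans (∧-comm (Rep n a b) _) (cong (_∧ Rep n a b) (≡ᵇ-sym a (3 * b)))))
                 (∑-indicator N (3 * b) (λ a → Rep n a b))))

quadruple : ℕ → ℕ
quadruple x = (x + x) + (x + x)

quadruple-≡ᵇ : ∀ x l → (quadruple x ≡ᵇ quadruple l) ≡ (x ≡ᵇ l)
quadruple-≡ᵇ x l = bool-ext (λ eq → ≡ᵇ-true (double-injective x l (double-injective (x + x) (l + l) (≡ᵇ-sound _ _ eq))))
                            (λ eq → ≡ᵇ-true (cong quadruple (≡ᵇ-sound x l eq)))

V₂V₂Δ≡∑ : ∀ t M → t < M → V₂ (V₂ Δ) t ≡ ∑ M (λ a → isOdd a ∧ (quadruple (a * a) ≡ᵇ t))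
V₂V₂Δ≡∑ t M t<M with parity t
... | k , inj₂ refl = trans (V₂-odd (V₂ Δ) k) (sym (∑-false M (λ a _ →
        trans (cong (isOdd a ∧_) (≡ᵇ-false (double≢suc-double (a * a + a * a) k))) (∧-zeroʳ _))))
... | k , inj₁ refl with parity k
...   | l , inj₁ refl = trans (V₂-even (V₂ Δ) (l + l)) (trans (V₂-even Δ l) (trans (Δ≡∑ M l l<M)
                          (∑-cong M (λ a → cong (isOdd a ∧_) (sym (quadruple-≡ᵇ (a * a) l))))))
  where
  l<M : l < M
  l<M = ≤-<-trans (≤-trans (m≤m+n l l) (m≤m+n (l + l) (l + l))) t<M
...   | l , inj₂ refl = trans (V₂-even (V₂ Δ) (suc (l + l))) (trans (V₂-odd Δ l) (sym (∑-false M (λ a _ →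
          trans (cong (isOdd a ∧_)
                      (≡ᵇ-false (λ eq → double≢suc-double (a * a) l (double-injective (a * a + a * a) (suc (l + l)) eq))))
                (∧-zeroʳ _)))))

∑Rep-a≡b : ∀ n → ∑ (suc n) (λ a → Rep n a a) ≡ V₂ (V₂ Δ) n
∑Rep-a≡b n = trans (∑-cong (suc n) diagonal) (sym (V₂V₂Δ≡∑ n (suc n) ≤-refl))
  where
  x+3x : ∀ x → x + 3 * x ≡ quadruple x
  x+3x = expand
    where
    expand : ∀ x → x + 3 * x ≡ (x + x) + (x + x)
    expand = solve-∀
  diagonal : ∀ a → Rep n a a ≡ (isOdd a ∧ (quadruple (a * a) ≡ᵇ n))
  diagonal a rewrite x+3x (a * a) with isOdd a
  ... | true = refl
  ... | false = refl

∑Rep-a≡3b : ∀ n → ∑ (suc n) (λ b → (3 * b <ᵇ suc n) ∧ Rep n (3 * b) b) ≡ V₃ (V₂ (V₂ Δ)) n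
∑Rep-a≡3b n = trans (∑-cong (suc n) diagonal) (sym V₃V₂V₂Δ≡∑)
  where
  norm-3b-b : ∀ b → norm (3 * b) b ≡ 3 * quadruple (b * b)
  norm-3b-b = expand
    where
    expand : ∀ b → (3 * b) * (3 * b) + 3 * (b * b) ≡ 3 * ((b * b + b * b) + (b * b + b * b))
    expand = solve-∀
  3b≤norm : ∀ b → 3 * b ≤ 3 * quadruple (b * b)
  3b≤norm b = *-monoʳ-≤ 3 (≤-trans (n≤n*n b) (≤-trans (m≤m+n (b * b) (b * b)) (m≤m+n (b * b + b * b) (b * b + b * b))))
  diagonal : ∀ b → ((3 * b <ᵇ suc n) ∧ Rep n (3 * b) b) ≡ (isOdd b ∧ (3 * quadruple (b * b) ≡ᵇ n))
  diagonal b rewrite norm-3b-b b | isOdd-3* b with isOdd b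
  ... | false = ∧-zeroʳ _
  ... | true = bool-ext (λ hyp → proj₂ (∧-true {3 * b <ᵇ suc n} hyp))
                        (λ hyp → trans (cong (_∧ (3 * quadruple (b * b) ≡ᵇ n))
                                              (<ᵇ-true (s≤s (≤-trans (3b≤norm b) (≤-reflexive (≡ᵇ-sound _ n hyp)))))) hyp)
  V₃V₂V₂Δ≡∑ : V₃ (V₂ (V₂ Δ)) n ≡ ∑ (suc n) (λ b → isOdd b ∧ (3 * quadruple (b * b) ≡ᵇ n))
  V₃V₂V₂Δ≡∑ with residue3 n
  ... | rem0 t = trans (V₃-rem0 _ t) (trans (V₂V₂Δ≡∑ t (suc (3 * t)) (s≤s (m≤n*m t 3)))
                   (∑-cong (suc (3 * t)) (λ b → cong (isOdd b ∧_) (sym (3*-≡ᵇ (quadruple (b * b)) t)))))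
  ... | rem1 t = trans (V₃-rem1 _ t) (sym (∑-false (suc (suc (3 * t))) (λ b _ →
                   trans (cong (isOdd b ∧_) (≡ᵇ-false (3*≢r+3* (quadruple (b * b)) 1 t (s≤s z≤n) (s≤s (s≤s z≤n))))) (∧-zeroʳ _))))
  ... | rem2 t = trans (V₃-rem2 _ t) (sym (∑-false (suc (suc (suc (3 * t)))) (λ b _ →
                   trans (cong (isOdd b ∧_) (≡ᵇ-false (3*≢r+3* (quadruple (b * b)) 2 t (s≤s z≤n) ≤-refl))) (∧-zeroʳ _))))

-- The coefficient of qⁿ on the left is the parity of the number of odd solutions of n = a² + 3b²;
-- φ pairs them off except for its fixed points a = b and a = 3b, which give Δ(q⁴) and Δ(q¹²).
ΔV₃Δ≡V₂V₂Δ+V₃V₂V₂Δ : mulS Δ (V₃ Δ) ≗ addS (V₂ (V₂ Δ)) (V₃ (V₂ (V₂ Δ)))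
ΔV₃Δ≡V₂V₂Δ+V₃V₂V₂Δ n =
  trans (ΔV₃Δ≡∑Rep n) (trans (∑Rep≡∑fixed n) (trans (∑fixed≡diagonals n) (cong₂ _xor_ (∑Rep-a≡b n) (∑Rep-a≡3b n))))

-- The modular equation and the recurrence for T₃(Δᵏ)
Δ² Δ⁴ : Series
Δ² = mulS Δ Δ
Δ⁴ = mulS Δ² Δ²

Δ⁴≗V₂V₂Δ : Δ⁴ ≗ V₂ (V₂ Δ)
Δ⁴≗V₂V₂Δ n = trans (mulS-square Δ² n) (V₂-cong (mulS-square Δ) n)

xor-solveˡ : ∀ {a b c} → a ≡ b xor c → b ≡ a xor c
xor-solveˡ {b = b} {c} refl = sym (trans (xor-assoc b c c) (trans (cong (b xor_) (xor-same c)) (xor-identityʳ b)))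

xor-solveʳ : ∀ {a b c} → a ≡ b xor c → c ≡ a xor b
xor-solveʳ {b = b} {c} refl = sym (trans (xor-comm (b xor c) b) (xor-cancelˡ b c))

xor-shuffle : ∀ a b c d → (a xor b) xor (c xor d) ≡ (a xor d) xor (b xor c)
xor-shuffle a b c d = trans (cong ((a xor b) xor_) (xor-comm c d)) (interchange a b d c)

modular-equation : Δ⁴ ≗ addS (mulS Δ (V₃ Δ)) (V₃ Δ⁴)
modular-equation n = begin
  Δ⁴ n                                   ≡⟨ Δ⁴≗V₂V₂Δ n ⟩
  V₂ (V₂ Δ) n                            ≡⟨ xor-solveˡ {mulS Δ (V₃ Δ) n} (ΔV₃Δ≡V₂V₂Δ+V₃V₂V₂Δ n) ⟩
  mulS Δ (V₃ Δ) n xor V₃ (V₂ (V₂ Δ)) n   ≡⟨ cong (mulS Δ (V₃ Δ) n xor_) (V₃-cong Δ⁴≗V₂V₂Δ n) ⟨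
  mulS Δ (V₃ Δ) n xor V₃ Δ⁴ n            ∎
  where open ≡-Reasoning

powS-+ : ∀ f a b → powS f (a + b) ≗ mulS (powS f a) (powS f b)
powS-+ f zero b n = sym (mulS-identityˡ (powS f b) n)
powS-+ f (suc a) b n = trans (mulS-congˡ f (powS-+ f a b) n) (sym (mulS-assoc f (powS f a) (powS f b) n))

mulS-fourfold : ∀ f X → mulS f (mulS f (mulS f (mulS f X))) ≗ mulS (mulS (mulS f f) (mulS f f)) X
mulS-fourfold f X = begin
  mulS f (mulS f (mulS f (mulS f X)))    ≈⟨ mulS-congˡ f (mulS-congˡ f (mulS-assoc f f X)) ⟨
  mulS f (mulS f (mulS (mulS f f) X))    ≈⟨ mulS-congˡ f (mulS-assoc f (mulS f f) X) ⟨
  mulS f (mulS (mulS f (mulS f f)) X)    ≈⟨ mulS-assoc f (mulS f (mulS f f)) X ⟨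
  mulS (mulS f (mulS f (mulS f f))) X    ≈⟨ mulS-congʳ X (mulS-assoc f f (mulS f f)) ⟨
  mulS (mulS (mulS f f) (mulS f f)) X    ∎
  where open ≗-Reasoning

T₃-recurrence : ∀ k → T₃ (powS Δ (4 + k)) ≗ addS (mulS Δ (T₃ (powS Δ (1 + k)))) (mulS Δ⁴ (T₃ (powS Δ k)))
T₃-recurrence k = begin
  T₃ (powS Δ (4 + k))
    ≈⟨ T₃≗U₃+V₃ (powS Δ (4 + k)) ⟩
  addS (U₃ (powS Δ (4 + k))) (V₃ (powS Δ (4 + k)))
    ≈⟨ addS-cong U₃-part V₃-part ⟩
  addS (addS (mulS Δ (U₃ Δᵏ⁺¹)) (mulS Δ⁴ (U₃ Δᵏ))) (addS (mulS Δ⁴ (V₃ Δᵏ)) (mulS Δ (V₃ Δᵏ⁺¹)))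
    ≈⟨ regroup ⟩
  addS (mulS Δ (T₃ Δᵏ⁺¹)) (mulS Δ⁴ (T₃ Δᵏ)) ∎
  where
  open ≗-Reasoning
  Δᵏ Δᵏ⁺¹ : Series
  Δᵏ = powS Δ k
  Δᵏ⁺¹ = powS Δ (1 + k)
  Δᵏ⁺⁴≗ : powS Δ (4 + k) ≗ addS (mulS Δᵏ⁺¹ (V₃ Δ)) (mulS Δᵏ (V₃ Δ⁴))
  Δᵏ⁺⁴≗ = begin
    powS Δ (4 + k)                                      ≈⟨ mulS-fourfold Δ Δᵏ ⟩
    mulS Δ⁴ Δᵏ                                          ≈⟨ mulS-congʳ Δᵏ modular-equation ⟩
    mulS (addS (mulS Δ (V₃ Δ)) (V₃ Δ⁴)) Δᵏ              ≈⟨ mulS-distribʳ Δᵏ (mulS Δ (V₃ Δ)) (V₃ Δ⁴) ⟩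
    addS (mulS (mulS Δ (V₃ Δ)) Δᵏ) (mulS (V₃ Δ⁴) Δᵏ)    ≈⟨ addS-cong reorder (mulS-comm (V₃ Δ⁴) Δᵏ) ⟩
    addS (mulS Δᵏ⁺¹ (V₃ Δ)) (mulS Δᵏ (V₃ Δ⁴))           ∎
    where
    reorder : mulS (mulS Δ (V₃ Δ)) Δᵏ ≗ mulS Δᵏ⁺¹ (V₃ Δ)
    reorder n = trans (mulS-assoc Δ (V₃ Δ) Δᵏ n)
                      (trans (mulS-congˡ Δ (mulS-comm (V₃ Δ) Δᵏ) n) (sym (mulS-assoc Δ Δᵏ (V₃ Δ) n)))
  U₃-part : U₃ (powS Δ (4 + k)) ≗ addS (mulS Δ (U₃ Δᵏ⁺¹)) (mulS Δ⁴ (U₃ Δᵏ))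
  U₃-part n = trans (Δᵏ⁺⁴≗ (3 * n)) (cong₂ _xor_ (U₃-mulS-V₃ Δᵏ⁺¹ Δ n) (U₃-mulS-V₃ Δᵏ Δ⁴ n))
  V₃-part : V₃ (powS Δ (4 + k)) ≗ addS (mulS Δ⁴ (V₃ Δᵏ)) (mulS Δ (V₃ Δᵏ⁺¹))
  V₃-part = begin
    V₃ (powS Δ (4 + k))                                 ≈⟨ V₃-cong (mulS-fourfold Δ Δᵏ) ⟩
    V₃ (mulS Δ⁴ Δᵏ)                                     ≈⟨ V₃-mulS Δ⁴ Δᵏ ⟩
    mulS (V₃ Δ⁴) (V₃ Δᵏ)
      ≈⟨ mulS-congʳ (V₃ Δᵏ) (λ n → xor-solveʳ {Δ⁴ n} {mulS Δ (V₃ Δ) n} (modular-equation n)) ⟩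
    mulS (addS Δ⁴ (mulS Δ (V₃ Δ))) (V₃ Δᵏ)              ≈⟨ mulS-distribʳ (V₃ Δᵏ) Δ⁴ (mulS Δ (V₃ Δ)) ⟩
    addS (mulS Δ⁴ (V₃ Δᵏ)) (mulS (mulS Δ (V₃ Δ)) (V₃ Δᵏ))
      ≈⟨ addS-cong {mulS Δ⁴ (V₃ Δᵏ)} (λ _ → refl) (λ n → trans (mulS-assoc Δ (V₃ Δ) (V₃ Δᵏ) n)
                                                           (mulS-congˡ Δ (λ m → sym (V₃-mulS Δ Δᵏ m)) n)) ⟩
    addS (mulS Δ⁴ (V₃ Δᵏ)) (mulS Δ (V₃ Δᵏ⁺¹))           ∎
  regroup : addS (addS (mulS Δ (U₃ Δᵏ⁺¹)) (mulS Δ⁴ (U₃ Δᵏ))) (addS (mulS Δ⁴ (V₃ Δᵏ)) (mulS Δ (V₃ Δᵏ⁺¹)))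
          ≗ addS (mulS Δ (T₃ Δᵏ⁺¹)) (mulS Δ⁴ (T₃ Δᵏ))
  regroup = begin
    addS (addS (mulS Δ (U₃ Δᵏ⁺¹)) (mulS Δ⁴ (U₃ Δᵏ))) (addS (mulS Δ⁴ (V₃ Δᵏ)) (mulS Δ (V₃ Δᵏ⁺¹)))
      ≈⟨ (λ n → xor-shuffle (mulS Δ (U₃ Δᵏ⁺¹) n) (mulS Δ⁴ (U₃ Δᵏ) n) (mulS Δ⁴ (V₃ Δᵏ) n) (mulS Δ (V₃ Δᵏ⁺¹) n)) ⟩
    addS (addS (mulS Δ (U₃ Δᵏ⁺¹)) (mulS Δ (V₃ Δᵏ⁺¹))) (addS (mulS Δ⁴ (U₃ Δᵏ)) (mulS Δ⁴ (V₃ Δᵏ)))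
      ≈⟨ addS-cong (mulS-distribˡ Δ (U₃ Δᵏ⁺¹) (V₃ Δᵏ⁺¹)) (mulS-distribˡ Δ⁴ (U₃ Δᵏ) (V₃ Δᵏ)) ⟨
    addS (mulS Δ (addS (U₃ Δᵏ⁺¹) (V₃ Δᵏ⁺¹))) (mulS Δ⁴ (addS (U₃ Δᵏ) (V₃ Δᵏ)))
      ≈⟨ addS-cong (mulS-congˡ Δ (T₃≗U₃+V₃ Δᵏ⁺¹)) (mulS-congˡ Δ⁴ (T₃≗U₃+V₃ Δᵏ)) ⟨
    addS (mulS Δ (T₃ Δᵏ⁺¹)) (mulS Δ⁴ (T₃ Δᵏ)) ∎

mulS-lowest : ∀ f g n → f 0 ≡ false → f 1 ≡ true → (∀ i → i < n → g i ≡ false) → mulS f g (suc n) ≡ g n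
mulS-lowest f g n f0 f1 g<n = begin
  mulS f g (suc n)                           ≡⟨ mulS-∑ f g (suc n) ⟩
  ∑ (suc (suc n)) F                          ≡⟨ ∑-head (suc n) F ⟩
  F 0 xor ∑ (suc n) (F ∘ suc)                ≡⟨ cong (F 0 xor_) (∑-head n (F ∘ suc)) ⟩
  F 0 xor (F 1 xor ∑ n (λ i → F (2 + i)))    ≡⟨ cong₂ (λ a b → a xor (F 1 xor b)) (cong (_∧ g (suc n)) f0) (∑-false n rest) ⟩
  F 1 xor false                              ≡⟨ xor-identityʳ _ ⟩
  f 1 ∧ g n                                  ≡⟨ cong (_∧ g n) f1 ⟩
  g n                                        ∎
  where
  open ≡-Reasoning
  F : ℕ → Bool
  F i = f i ∧ g (suc n ∸ i)
  rest : ∀ i → i < n → F (2 + i) ≡ false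
  rest i i<n = trans (cong (f (2 + i) ∧_) (g<n (n ∸ suc i) (n∸1+i<n i<n))) (∧-zeroʳ _)
    where
    n∸1+i<n : ∀ {n i} → i < n → n ∸ suc i < n
    n∸1+i<n {suc n} {i} _ = s≤s (m∸n≤m n i)

zero-below : ∀ (g : Series) → (∀ n → (∀ i → i < n → g i ≡ false) → g n ≡ false) → g ≗ zeroS
zero-below g step n = <-rec (λ n → g n ≡ false) (λ n rec → step n (λ i i<n → rec i<n)) n

mulS-cancel : ∀ f g → f 0 ≡ false → f 1 ≡ true → mulS f g ≗ zeroS → g ≗ zeroS
mulS-cancel f g f0 f1 fg≗0 = zero-below g (λ n g<n → trans (sym (mulS-lowest f g n f0 f1 g<n)) (fg≗0 (suc n)))

V₃-oneS : V₃ oneS ≗ oneS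
V₃-oneS zero = refl
V₃-oneS (suc zero) = refl
V₃-oneS (suc (suc zero)) = refl
V₃-oneS (suc (suc (suc n))) = V₃-zeroS n
  where
  V₃-zeroS : V₃ zeroS ≗ zeroS
  V₃-zeroS zero = refl
  V₃-zeroS (suc zero) = refl
  V₃-zeroS (suc (suc zero)) = refl
  V₃-zeroS (suc (suc (suc n))) = V₃-zeroS n

T₃-Δ⁰ : T₃ (powS Δ 0) ≗ zeroS
T₃-Δ⁰ n = trans (T₃≗U₃+V₃ oneS n) (trans (cong₂ _xor_ (U₃-oneS n) (V₃-oneS n)) (xor-same (oneS n)))
  where
  U₃-oneS : U₃ oneS ≗ oneS
  U₃-oneS zero = refl
  U₃-oneS (suc n) = refl

V₂V₂-low : ∀ g n → (∀ i → i < n → g i ≡ false) → V₂ (V₂ g) (suc n) ≡ false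
V₂V₂-low g n g<n with parity (suc n)
... | k , inj₂ 1+n≡ = trans (cong (V₂ (V₂ g)) 1+n≡) (V₂-odd (V₂ g) k)
... | k , inj₁ 1+n≡ with parity k
...   | l , inj₂ refl = trans (cong (V₂ (V₂ g)) 1+n≡) (trans (V₂-even (V₂ g) (suc (l + l))) (V₂-odd g l))
...   | l , inj₁ refl = trans (cong (V₂ (V₂ g)) 1+n≡) (trans (V₂-even (V₂ g) (l + l)) (trans (V₂-even g l) (g<n l (l<n l n 1+n≡))))
  where
  l<n : ∀ l n → suc n ≡ (l + l) + (l + l) → l < n
  l<n (suc l) n eq = ≤-trans (m≤m+n (suc (suc l)) (l + l + l + 1)) (≤-reflexive (suc-injective (trans (sym (regroup l)) (sym eq))))
    where
    regroup : ∀ l → (suc l + suc l) + (suc l + suc l) ≡ suc (suc (suc l) + (l + l + l + 1))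
    regroup = solve-∀

T₃-Δ : T₃ Δ ≗ zeroS
T₃-Δ = zero-below (T₃ Δ) (λ n low → trans (sym (mulS-lowest Δ (T₃ Δ) n refl refl low))
                                           (trans (sym (fourth-power (suc n))) (V₂V₂-low (T₃ Δ) n low)))
  where
  fourth-power : V₂ (V₂ (T₃ Δ)) ≗ mulS Δ (T₃ Δ)
  fourth-power = begin
    V₂ (V₂ (T₃ Δ))                                ≈⟨ mulS-square (V₂ (T₃ Δ)) ⟨
    mulS (V₂ (T₃ Δ)) (V₂ (T₃ Δ))                  ≈⟨ mulS-cong (mulS-square (T₃ Δ)) (mulS-square (T₃ Δ)) ⟨
    mulS (mulS (T₃ Δ) (T₃ Δ)) (mulS (T₃ Δ) (T₃ Δ)) ≈⟨ mulS-cong (T₃-square Δ) (T₃-square Δ) ⟨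
    mulS (T₃ Δ²) (T₃ Δ²)                          ≈⟨ T₃-square Δ² ⟨
    T₃ Δ⁴                                         ≈⟨ T₃-cong (λ n → trans (mulS-fourfold Δ oneS n) (mulS-identityʳ Δ⁴ n)) ⟨
    T₃ (powS Δ 4)                                 ≈⟨ T₃-recurrence 0 ⟩
    addS (mulS Δ (T₃ (powS Δ 1))) (mulS Δ⁴ (T₃ (powS Δ 0)))
                                                  ≈⟨ addS-cong (mulS-congˡ Δ (T₃-cong (mulS-identityʳ Δ)))
                                                               (λ n → trans (mulS-congˡ Δ⁴ T₃-Δ⁰ n) (mulS-zeroʳ Δ⁴ n)) ⟩
    addS (mulS Δ (T₃ Δ)) zeroS                    ≈⟨ (λ n → xor-identityʳ _) ⟩
    mulS Δ (T₃ Δ)                                 ∎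
    where open ≗-Reasoning

T₃-Δ¹ : T₃ (powS Δ 1) ≗ zeroS
T₃-Δ¹ n = trans (T₃-cong (mulS-identityʳ Δ) n) (T₃-Δ n)

T₃-Δ² : T₃ (powS Δ 2) ≗ zeroS
T₃-Δ² = begin
  T₃ (powS Δ 2)            ≈⟨ T₃-cong (mulS-congˡ Δ (mulS-identityʳ Δ)) ⟩
  T₃ Δ²                    ≈⟨ T₃-square Δ ⟩
  mulS (T₃ Δ) (T₃ Δ)       ≈⟨ mulS-congʳ (T₃ Δ) T₃-Δ ⟩
  mulS zeroS (T₃ Δ)        ≈⟨ mulS-zeroˡ (T₃ Δ) ⟩
  zeroS                    ∎
  where open ≗-Reasoning

T₃-Δ³ : T₃ (powS Δ 3) ≗ Δ
T₃-Δ³ n = xor≡false⇒≡ (mulS-cancel S (addS S Δ) refl refl S[S+Δ]≗0 n)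
  where
  S : Series
  S = T₃ (powS Δ 3)
  S²≗ΔS : mulS S S ≗ mulS Δ S
  S²≗ΔS = begin
    mulS S S                                          ≈⟨ T₃-square (powS Δ 3) ⟨
    T₃ (mulS (powS Δ 3) (powS Δ 3))                   ≈⟨ T₃-cong (powS-+ Δ 3 3) ⟨
    T₃ (powS Δ 6)                                     ≈⟨ T₃-recurrence 2 ⟩
    addS (mulS Δ S) (mulS Δ⁴ (T₃ (powS Δ 2)))
      ≈⟨ (λ n → cong (mulS Δ S n xor_) (trans (mulS-congˡ Δ⁴ T₃-Δ² n) (mulS-zeroʳ Δ⁴ n))) ⟩
    addS (mulS Δ S) zeroS                             ≈⟨ (λ n → xor-identityʳ _) ⟩
    mulS Δ S                                          ∎
    where open ≗-Reasoning
  S[S+Δ]≗0 : mulS S (addS S Δ) ≗ zeroS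
  S[S+Δ]≗0 n = trans (mulS-distribˡ S S Δ n) (trans (cong₂ _xor_ (S²≗ΔS n) (mulS-comm S Δ n)) (xor-same (mulS Δ S n)))

addP : Poly → Poly → Poly
addP [] q = q
addP (x ∷ p) [] = x ∷ p
addP (x ∷ p) (y ∷ q) = (x xor y) ∷ addP p q

coeff-addP : ∀ p q i → coeff (addP p q) i ≡ coeff p i xor coeff q i
coeff-addP [] q i = refl
coeff-addP (x ∷ p) [] zero = sym (xor-identityʳ x)
coeff-addP (x ∷ p) [] (suc i) = sym (xor-identityʳ _)
coeff-addP (x ∷ p) (y ∷ q) zero = refl
coeff-addP (x ∷ p) (y ∷ q) (suc i) = coeff-addP p q i

constS : Bool → Series
constS b = if b then oneS else zeroS

constS-xor : ∀ x y → constS (x xor y) ≗ addS (constS x) (constS y)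
constS-xor false y n = refl
constS-xor true false n = sym (xor-identityʳ _)
constS-xor true true n = sym (xor-same (oneS n))

evalAtΔ-addP : ∀ p q → evalAtΔ (addP p q) ≗ addS (evalAtΔ p) (evalAtΔ q)
evalAtΔ-addP [] q n = refl
evalAtΔ-addP (x ∷ p) [] n = sym (xor-identityʳ _)
evalAtΔ-addP (x ∷ p) (y ∷ q) n = begin
  constS (x xor y) n xor mulS Δ (evalAtΔ (addP p q)) n
    ≡⟨ cong₂ _xor_ (constS-xor x y n) (trans (mulS-congˡ Δ (evalAtΔ-addP p q) n) (mulS-distribˡ Δ (evalAtΔ p) (evalAtΔ q) n)) ⟩
  (constS x n xor constS y n) xor (mulS Δ (evalAtΔ p) n xor mulS Δ (evalAtΔ q) n)
    ≡⟨ interchange (constS x n) (constS y n) (mulS Δ (evalAtΔ p) n) (mulS Δ (evalAtΔ q) n) ⟩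
  (constS x n xor mulS Δ (evalAtΔ p) n) xor (constS y n xor mulS Δ (evalAtΔ q) n) ∎
  where open ≡-Reasoning

-- P[ k ] is the polynomial P_k of the statement, built from T₃-recurrence: P_{k+4} = x P_{k+1} + x⁴ P_k.
P[_] : ℕ → Poly
P[ 0 ] = []
P[ 1 ] = []
P[ 2 ] = []
P[ 3 ] = false ∷ true ∷ []
P[ suc (suc (suc (suc k))) ] = addP (false ∷ P[ suc k ]) (false ∷ false ∷ false ∷ false ∷ P[ k ])

evalAtΔ-P[] : ∀ k → evalAtΔ P[ k ] ≗ T₃ (powS Δ k)
evalAtΔ-P[] 0 n = sym (T₃-Δ⁰ n)
evalAtΔ-P[] 1 n = sym (T₃-Δ¹ n)
evalAtΔ-P[] 2 n = sym (T₃-Δ² n)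
evalAtΔ-P[] 3 n = begin
  mulS Δ (addS oneS (mulS Δ zeroS)) n
    ≡⟨ mulS-congˡ Δ (λ m → trans (cong (oneS m xor_) (mulS-zeroʳ Δ m)) (xor-identityʳ (oneS m))) n ⟩
  mulS Δ oneS n                         ≡⟨ mulS-identityʳ Δ n ⟩
  Δ n                                   ≡⟨ T₃-Δ³ n ⟨
  T₃ (powS Δ 3) n                       ∎
  where open ≡-Reasoning
evalAtΔ-P[] (suc (suc (suc (suc k)))) = begin
  evalAtΔ P[ 4 + k ]
    ≈⟨ evalAtΔ-addP (false ∷ P[ suc k ]) (false ∷ false ∷ false ∷ false ∷ P[ k ]) ⟩
  addS (mulS Δ (evalAtΔ P[ suc k ])) (mulS Δ (mulS Δ (mulS Δ (mulS Δ (evalAtΔ P[ k ])))))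
    ≈⟨ addS-cong (mulS-congˡ Δ (evalAtΔ-P[] (suc k)))
                 (λ n → trans (mulS-fourfold Δ (evalAtΔ P[ k ]) n) (mulS-congˡ Δ⁴ (evalAtΔ-P[] k) n)) ⟩
  addS (mulS Δ (T₃ (powS Δ (suc k)))) (mulS Δ⁴ (T₃ (powS Δ k)))
    ≈⟨ T₃-recurrence k ⟨
  T₃ (powS Δ (4 + k)) ∎
  where open ≗-Reasoning

evalAtΔ≗0 : ∀ p → evalAtΔ p ≗ zeroS → ∀ d → coeff p d ≡ false
evalAtΔ≗0 [] p≗0 d = refl
evalAtΔ≗0 (true ∷ p) p≗0 d with p≗0 0
... | ()
evalAtΔ≗0 (false ∷ p) p≗0 zero = refl
evalAtΔ≗0 (false ∷ p) p≗0 (suc d) = evalAtΔ≗0 p (mulS-cancel Δ (evalAtΔ p) refl refl p≗0) d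

evalAtΔ-injective : ∀ p q → evalAtΔ p ≗ evalAtΔ q → ∀ d → coeff p d ≡ coeff q d
evalAtΔ-injective p q p≗q d = xor≡false⇒≡ (trans (sym (coeff-addP p q d)) (evalAtΔ≗0 (addP p q) p+q≗0 d))
  where
  p+q≗0 : evalAtΔ (addP p q) ≗ zeroS
  p+q≗0 n = trans (evalAtΔ-addP p q n) (trans (cong (_xor evalAtΔ q n) (p≗q n)) (xor-same (evalAtΔ q n)))

Exponent : ℕ → ℕ → Set
Exponent k d = ∃[ a ] ∃[ b ] (3 + 3 * a + 4 * b ≡ k × 1 + a + 4 * b ≡ d)

P[]-exponent : ∀ k d → coeff P[ k ] d ≡ true → Exponent k d
P[]-exponent 3 1 _ = 0 , 0 , refl , refl
P[]-exponent 3 (suc (suc d)) ()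
P[]-exponent (suc (suc (suc (suc k)))) d Pd =
  from-sum d (trans (sym (coeff-addP (false ∷ P[ suc k ]) (false ∷ false ∷ false ∷ false ∷ P[ k ]) d)) Pd)
  where
  k-a : ∀ a b → 3 + 3 * suc a + 4 * b ≡ 3 + (3 + 3 * a + 4 * b)
  k-a = solve-∀
  k-b : ∀ a b → 3 + 3 * a + 4 * suc b ≡ 4 + (3 + 3 * a + 4 * b)
  k-b = solve-∀
  d-b : ∀ a b → 1 + a + 4 * suc b ≡ 4 + (1 + a + 4 * b)
  d-b = solve-∀
  from-x⁴ : ∀ d → coeff (false ∷ false ∷ false ∷ P[ k ]) d ≡ true → Exponent (4 + k) (suc d)
  from-x⁴ (suc (suc (suc d))) Pd with P[]-exponent k d Pd
  ... | a , b , refl , refl = a , suc b , k-b a b , d-b a b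
  from-sum : ∀ d → (coeff (false ∷ P[ suc k ]) d xor coeff (false ∷ false ∷ false ∷ false ∷ P[ k ]) d) ≡ true →
             Exponent (4 + k) d
  from-sum (suc d) Pd with coeff P[ suc k ] d in P₁d
  ... | true with P[]-exponent (suc k) d P₁d
  ...   | a , b , refl , refl = suc a , b , k-a a b , refl
  from-sum (suc d) Pd | false = from-x⁴ d Pd

-- binom₂ a b is the binomial coefficient (a+b choose a) mod 2, given by Pascal's rule
binom₂ : ℕ → ℕ → Bool
binom₂ zero b = true
binom₂ (suc a) zero = true
binom₂ (suc a) (suc b) = binom₂ a (suc b) xor binom₂ (suc a) b

coeff-false : ∀ k d → ¬ Exponent k d → coeff P[ k ] d ≡ false
coeff-false k d ¬exp with coeff P[ k ] d in Pd
... | true = ⊥-elim (¬exp (P[]-exponent k d Pd))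
... | false = refl

m≢m+suc : ∀ m x → m ≢ m + suc x
m≢m+suc m x eq = m≢1+m+n m (trans eq (+-suc m x))

binom₂-zeroʳ : ∀ a → binom₂ a 0 ≡ true
binom₂-zeroʳ zero = refl
binom₂-zeroʳ (suc a) = refl

coeff-P[]-a : ∀ a b → coeff P[ 3 + 3 * suc a + 4 * b ] (1 + suc a + 4 * b)
                     ≡ coeff P[ 3 + 3 * a + 4 * b ] (1 + a + 4 * b) xor coeff (false ∷ false ∷ P[ 2 + 3 * a + 4 * b ]) (a + 4 * b)
coeff-P[]-a a b = trans (cong₂ (λ k d → coeff P[ k ] d) (k≡ a b) (d≡ a b))
  (coeff-addP (false ∷ P[ 3 + 3 * a + 4 * b ]) (false ∷ false ∷ false ∷ false ∷ P[ 2 + 3 * a + 4 * b ]) (suc (1 + a + 4 * b)))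
  where
  k≡ : ∀ a b → 3 + 3 * suc a + 4 * b ≡ 4 + (2 + 3 * a + 4 * b)
  k≡ = solve-∀
  d≡ : ∀ a b → 1 + suc a + 4 * b ≡ suc (1 + a + 4 * b)
  d≡ = solve-∀

x⁴-term-b : ∀ a b → coeff (false ∷ false ∷ P[ 2 + 3 * a + 4 * suc b ]) (a + 4 * suc b)
                   ≡ coeff P[ 3 + 3 * suc a + 4 * b ] (1 + suc a + 4 * b)
x⁴-term-b a b = cong₂ (λ k d → coeff (false ∷ false ∷ P[ k ]) d) (k≡ a b) (d≡ a b)
  where
  k≡ : ∀ a b → 2 + 3 * a + 4 * suc b ≡ 3 + 3 * suc a + 4 * b
  k≡ = solve-∀
  d≡ : ∀ a b → a + 4 * suc b ≡ 2 + (1 + suc a + 4 * b)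
  d≡ = solve-∀

x⁴-term-0 : ∀ a → coeff (false ∷ false ∷ P[ 2 + 3 * a + 4 * 0 ]) (a + 4 * 0) ≡ false
x⁴-term-0 zero = refl
x⁴-term-0 (suc zero) = refl
x⁴-term-0 (suc (suc a)) = trans (cong₂ (λ k d → coeff P[ k ] d) (k≡ a) (+-identityʳ a)) no-exponent
  where
  k≡ : ∀ a → 2 + 3 * suc (suc a) + 4 * 0 ≡ 2 + 3 * (2 + a)
  k≡ = solve-∀
  regroup : ∀ x y → 2 + 3 * (2 + (1 + x + 4 * y)) ≡ (3 + 3 * x + 4 * y) + suc (7 + 8 * y)
  regroup = solve-∀
  no-exponent : coeff P[ 2 + 3 * (2 + a) ] a ≡ false
  no-exponent = coeff-false (2 + 3 * (2 + a)) a (λ { (x , y , k≡ , d≡) →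
    m≢m+suc (3 + 3 * x + 4 * y) (7 + 8 * y) (trans k≡ (trans (cong (λ z → 2 + 3 * (2 + z)) (sym d≡)) (regroup x y))) })

coeff-P[]≡binom₂ : ∀ a b → coeff P[ 3 + 3 * a + 4 * b ] (1 + a + 4 * b) ≡ binom₂ a b
coeff-P[]≡binom₂ zero zero = refl
coeff-P[]≡binom₂ zero (suc b) = trans step (coeff-P[]≡binom₂ zero b)
  where
  k≡ : ∀ b → 3 + 3 * 0 + 4 * suc b ≡ 4 + (3 + 4 * b)
  k≡ = solve-∀
  d≡ : ∀ b → 1 + 0 + 4 * suc b ≡ 5 + 4 * b
  d≡ = solve-∀
  regroup : ∀ x y → 3 + 3 * x + 4 * y ≡ (1 + x + 4 * y) + suc (1 + 2 * x)
  regroup = solve-∀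
  no-exponent : coeff P[ 4 + 4 * b ] (4 + 4 * b) ≡ false
  no-exponent = coeff-false (4 + 4 * b) (4 + 4 * b) (λ { (x , y , k≡ , d≡) →
    m≢m+suc (1 + x + 4 * y) (1 + 2 * x) (trans (trans d≡ (sym k≡)) (regroup x y)) })
  step : coeff P[ 3 + 3 * 0 + 4 * suc b ] (1 + 0 + 4 * suc b) ≡ coeff P[ 3 + 3 * 0 + 4 * b ] (1 + 0 + 4 * b)
  step = trans (cong₂ (λ k d → coeff P[ k ] d) (k≡ b) (d≡ b))
               (trans (coeff-addP (false ∷ P[ 4 + 4 * b ]) (false ∷ false ∷ false ∷ false ∷ P[ 3 + 4 * b ]) (5 + 4 * b))
                      (cong (_xor coeff P[ 3 + 4 * b ] (1 + 4 * b)) no-exponent))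
coeff-P[]≡binom₂ (suc a) zero =
  trans (coeff-P[]-a a 0) (trans (cong₂ _xor_ (coeff-P[]≡binom₂ a 0) (x⁴-term-0 a)) (cong (_xor false) (binom₂-zeroʳ a)))
coeff-P[]≡binom₂ (suc a) (suc b) =
  trans (coeff-P[]-a a (suc b)) (cong₂ _xor_ (coeff-P[]≡binom₂ a (suc b)) (trans (x⁴-term-b a b) (coeff-P[]≡binom₂ (suc a) b)))

P[]-support : ∀ k d → coeff P[ k ] d ≡ true →
              ∃[ a ] ∃[ b ] (k ≡ 3 + 3 * a + 4 * b × d ≡ 1 + a + 4 * b × binom₂ a b ≡ true)
P[]-support k d Pd with P[]-exponent k d Pd
... | a , b , refl , refl = a , b , refl , refl , trans (sym (coeff-P[]≡binom₂ a b)) Pd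

-- Lucas' theorem
double : ℕ → ℕ
double zero = zero
double (suc n) = suc (suc (double n))

double≡2* : ∀ n → double n ≡ 2 * n
double≡2* zero = refl
double≡2* (suc n) = trans (cong (suc ∘ suc) (double≡2* n)) (sym (*-suc 2 n))

binom₂-even-even : ∀ a b → binom₂ (double a) (double b) ≡ binom₂ a b
binom₂-odd-even : ∀ a b → binom₂ (suc (double a)) (double b) ≡ binom₂ a b
binom₂-even-odd : ∀ a b → binom₂ (double a) (suc (double b)) ≡ binom₂ a b
binom₂-odd-odd : ∀ a b → binom₂ (suc (double a)) (suc (double b)) ≡ false

binom₂-even-even zero b = refl
binom₂-even-even (suc a) zero = refl
binom₂-even-even (suc a) (suc b) = cong₂ _xor_ (binom₂-odd-even a (suc b)) (binom₂-even-odd (suc a) b)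
binom₂-odd-even a zero = sym (binom₂-zeroʳ a)
binom₂-odd-even a (suc b) = trans (cong₂ _xor_ (binom₂-even-even a (suc b)) (binom₂-odd-odd a b)) (xor-identityʳ _)
binom₂-even-odd zero b = refl
binom₂-even-odd (suc a) b = cong₂ _xor_ (binom₂-odd-odd a b) (binom₂-even-even (suc a) b)
binom₂-odd-odd a b = trans (cong₂ _xor_ (binom₂-even-odd a b) (binom₂-odd-even a b)) (xor-same (binom₂ a b))

lucas₂ : ∀ a₀ b₀ A B → a₀ < 2 → b₀ < 2 → binom₂ (a₀ + 2 * A) (b₀ + 2 * B) ≡ binom₂ a₀ b₀ ∧ binom₂ A B
lucas₂ a₀ b₀ A B a₀<2 b₀<2 rewrite sym (double≡2* A) | sym (double≡2* B) = digits a₀<2 b₀<2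
  where
  digits : a₀ < 2 → b₀ < 2 → binom₂ (a₀ + double A) (b₀ + double B) ≡ binom₂ a₀ b₀ ∧ binom₂ A B
  digits (s≤s z≤n)       (s≤s z≤n)       = binom₂-even-even A B
  digits (s≤s z≤n)       (s≤s (s≤s z≤n)) = binom₂-even-odd A B
  digits (s≤s (s≤s z≤n)) (s≤s z≤n)       = binom₂-odd-even A B
  digits (s≤s (s≤s z≤n)) (s≤s (s≤s z≤n)) = binom₂-odd-odd A B

lucas₄ : ∀ a₀ b₀ A B → a₀ < 4 → b₀ < 4 → binom₂ (a₀ + 4 * A) (b₀ + 4 * B) ≡ binom₂ a₀ b₀ ∧ binom₂ A B
lucas₄ a₀ b₀ A B a₀<4 b₀<4 = begin
  binom₂ (a₀ + 4 * A) (b₀ + 4 * B)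
    ≡⟨ cong₂ binom₂ (regroup a₀ A) (regroup b₀ B) ⟩
  binom₂ (a₀ % 2 + 2 * (a₀ / 2 + 2 * A)) (b₀ % 2 + 2 * (b₀ / 2 + 2 * B))
    ≡⟨ lucas₂ (a₀ % 2) (b₀ % 2) (a₀ / 2 + 2 * A) (b₀ / 2 + 2 * B) (m%n<n a₀ 2) (m%n<n b₀ 2) ⟩
  binom₂ (a₀ % 2) (b₀ % 2) ∧ binom₂ (a₀ / 2 + 2 * A) (b₀ / 2 + 2 * B)
    ≡⟨ cong (binom₂ (a₀ % 2) (b₀ % 2) ∧_) (lucas₂ (a₀ / 2) (b₀ / 2) A B (m<n*o⇒m/o<n a₀<4) (m<n*o⇒m/o<n b₀<4)) ⟩
  binom₂ (a₀ % 2) (b₀ % 2) ∧ (binom₂ (a₀ / 2) (b₀ / 2) ∧ binom₂ A B)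
    ≡⟨ sym (∧-assoc (binom₂ (a₀ % 2) (b₀ % 2)) (binom₂ (a₀ / 2) (b₀ / 2)) (binom₂ A B)) ⟩
  (binom₂ (a₀ % 2) (b₀ % 2) ∧ binom₂ (a₀ / 2) (b₀ / 2)) ∧ binom₂ A B
    ≡⟨ cong (_∧ binom₂ A B) (trans (cong₂ binom₂ (binary a₀) (binary b₀))
                                   (lucas₂ (a₀ % 2) (b₀ % 2) (a₀ / 2) (b₀ / 2) (m%n<n a₀ 2) (m%n<n b₀ 2))) ⟨
  binom₂ a₀ b₀ ∧ binom₂ A B ∎
  where
  open ≡-Reasoning
  binary : ∀ a → a ≡ a % 2 + 2 * (a / 2)
  binary a = trans (m≡m%n+[m/n]*n a 2) (cong (a % 2 +_) (*-comm (a / 2) 2))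
  regroup : ∀ a A → a + 4 * A ≡ a % 2 + 2 * (a / 2 + 2 * A)
  regroup a A = trans (cong (_+ 4 * A) (binary a)) (reassoc (a % 2) (a / 2) A)
    where
    reassoc : ∀ r q A → (r + 2 * q) + 4 * A ≡ r + 2 * (q + 2 * A)
    reassoc = solve-∀

bitSum : ℕ → ℕ → ℕ → ℕ
bitSum o M x = sum (applyUpTo (λ j → bit (2 * j + o) x * 2 ^ j) M)

sum-double : ∀ M {F G : ℕ → ℕ} → (∀ j → F j ≡ 2 * G j) → sum (applyUpTo F M) ≡ 2 * sum (applyUpTo G M)
sum-double zero eq = refl
sum-double (suc M) {G = G} eq = trans (cong₂ _+_ (eq 0) (sum-double M (eq ∘ suc))) (sym (*-distribˡ-+ 2 (G 0) _))

bitSum-suc : ∀ o M x → bitSum o (suc M) x ≡ bit o x + 2 * bitSum o M (x / 2 / 2)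
bitSum-suc o M x = cong₂ _+_ (*-identityʳ (bit o x)) (sum-double M shift)
  where
  shift : ∀ j → bit (2 * suc j + o) x * 2 ^ suc j ≡ 2 * (bit (2 * j + o) (x / 2 / 2) * 2 ^ j)
  shift j = trans (cong (λ i → bit i x * 2 ^ suc j) (index j o)) (swap (bit (2 * j + o) (x / 2 / 2)) (2 ^ j))
    where
    index : ∀ j o → 2 * suc j + o ≡ suc (suc (2 * j + o))
    index = solve-∀
    swap : ∀ u v → u * (2 * v) ≡ 2 * (u * v)
    swap = solve-∀

bit-zero : ∀ i → bit i 0 ≡ 0
bit-zero zero = refl
bit-zero (suc i) = bit-zero i

quarter<suc : ∀ M y → y < suc (suc M) → y / 2 / 2 < suc M
quarter<suc M zero _ = s≤s z≤n
quarter<suc M (suc y) y<2+M = begin-strict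
  suc y / 2 / 2 ≤⟨ m/n≤m (suc y / 2) 2 ⟩
  suc y / 2     <⟨ m/n<m (suc y) 2 (s≤s (s≤s z≤n)) ⟩
  suc y         ≤⟨ ≤-pred y<2+M ⟩
  suc M         ∎
  where open ≤-Reasoning

bitSum-stable : ∀ o M y → y < suc M → bitSum o (suc M) y ≡ bitSum o M y
bitSum-stable o zero zero _ = cong (λ b → b * 1 + 0) (bit-zero o)
bitSum-stable o zero (suc y) (s≤s ())
bitSum-stable o (suc M) y y<2+M = begin
  bitSum o (suc (suc M)) y             ≡⟨ bitSum-suc o (suc M) y ⟩
  bit o y + 2 * bitSum o (suc M) (y / 2 / 2)
    ≡⟨ cong (λ s → bit o y + 2 * s) (bitSum-stable o M (y / 2 / 2) (quarter<suc M y y<2+M)) ⟩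
  bit o y + 2 * bitSum o M (y / 2 / 2)  ≡⟨ bitSum-suc o M y ⟨
  bitSum o (suc M) y                   ∎
  where open ≡-Reasoning

bitSum-fuel : ∀ o M y → y < M → bitSum o M y ≡ bitSum o (suc y) y
bitSum-fuel o (suc M) y y<1+M with m≤n⇒m<n∨m≡n (≤-pred y<1+M)
... | inj₁ y<M = trans (bitSum-stable o M y y<1+M) (bitSum-fuel o M y y<M)
... | inj₂ refl = refl

n₃≡bitSum : ∀ x → n₃ x ≡ bitSum 1 (suc x) x
n₃≡bitSum x = cong sum (map-upTo (λ j → bit (2 * j + 1) x * 2 ^ j) (suc x))

n₅≡bitSum : ∀ x → n₅ x ≡ bitSum 2 (suc x) x
n₅≡bitSum x = cong sum (map-upTo (λ j → bit (2 * j + 2) x * 2 ^ j) (suc x))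

-- h′ (Σ yᵢ 4ⁱ) = Σ yᵢ 2ⁱ for base-4 digits yᵢ (h′-digit): n₃ and n₅ read the two bits of each digit.
h′ : ℕ → ℕ
h′ y = y % 2 + 2 * h y

h-quarter : ∀ x → h x ≡ bit 1 x + h′ (x / 2 / 2)
h-quarter zero = refl
h-quarter (suc x₀) = begin
  n₃ x + n₅ x
    ≡⟨ cong₂ _+_ (n₃≡bitSum x) (n₅≡bitSum x) ⟩
  bitSum 1 (suc x) x + bitSum 2 (suc x) x
    ≡⟨ cong₂ _+_ (bitSum-suc 1 x x) (bitSum-suc 2 x x) ⟩
  (bit 1 x + 2 * bitSum 1 x x′) + (bit 2 x + 2 * bitSum 2 x x′)
    ≡⟨ cong₂ (λ u v → (bit 1 x + 2 * u) + (bit 2 x + 2 * v))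
             (trans (fuel 1) (sym (n₃≡bitSum x′))) (trans (fuel 2) (sym (n₅≡bitSum x′))) ⟩
  (bit 1 x + 2 * n₃ x′) + (bit 2 x + 2 * n₅ x′)
    ≡⟨ regroup (bit 1 x) (bit 2 x) (n₃ x′) (n₅ x′) ⟩
  bit 1 x + h′ x′ ∎
  where
  open ≡-Reasoning
  x x′ : ℕ
  x = suc x₀
  x′ = x / 2 / 2
  fuel : ∀ o → bitSum o x x′ ≡ bitSum o (suc x′) x′
  fuel o = bitSum-fuel o x x′ (quarter<suc x₀ x (n<1+n x))
  regroup : ∀ a b c d → (a + 2 * c) + (b + 2 * d) ≡ a + (b + 2 * (c + d))
  regroup = solve-∀

half-plus : ∀ r m → (r + m * 2) / 2 ≡ r / 2 + m
half-plus r m = trans (+-distrib-/-∣ʳ r (n∣m*n m)) (cong (r / 2 +_) (m*n/n≡m m 2))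

4*≡*2*2 : ∀ Y → 4 * Y ≡ Y * 2 * 2
4*≡*2*2 = solve-∀

quarter-digit : ∀ y₀ Y → y₀ < 4 → (y₀ + 4 * Y) / 2 / 2 ≡ Y
quarter-digit y₀ Y y₀<4
  rewrite 4*≡*2*2 Y | half-plus y₀ (Y * 2) | half-plus (y₀ / 2) Y | m<n⇒m/n≡0 {y₀ / 2} {2} (m<n*o⇒m/o<n {y₀} {2} {2} y₀<4) = refl

bit1-digit : ∀ y₀ Y → bit 1 (y₀ + 4 * Y) ≡ bit 1 y₀
bit1-digit y₀ Y rewrite 4*≡*2*2 Y | half-plus y₀ (Y * 2) = [m+kn]%n≡m%n (y₀ / 2) Y 2

parity-digit : ∀ y₀ Y → (y₀ + 4 * Y) % 2 ≡ y₀ % 2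
parity-digit y₀ Y rewrite 4*≡*2*2 Y = [m+kn]%n≡m%n y₀ (Y * 2) 2

binary-digit : ∀ y₀ → y₀ < 4 → y₀ % 2 + 2 * bit 1 y₀ ≡ y₀
binary-digit 0 _ = refl
binary-digit 1 _ = refl
binary-digit 2 _ = refl
binary-digit 3 _ = refl
binary-digit (suc (suc (suc (suc _)))) (s≤s (s≤s (s≤s (s≤s ()))))

h′-digit : ∀ y₀ Y → y₀ < 4 → h′ (y₀ + 4 * Y) ≡ y₀ + 2 * h′ Y
h′-digit y₀ Y y₀<4 = begin
  (y₀ + 4 * Y) % 2 + 2 * h (y₀ + 4 * Y)
    ≡⟨ cong₂ (λ u v → u + 2 * v) (parity-digit y₀ Y) (h-quarter (y₀ + 4 * Y)) ⟩
  y₀ % 2 + 2 * (bit 1 (y₀ + 4 * Y) + h′ ((y₀ + 4 * Y) / 2 / 2))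
    ≡⟨ cong₂ (λ u v → y₀ % 2 + 2 * (u + h′ v)) (bit1-digit y₀ Y) (quarter-digit y₀ Y y₀<4) ⟩
  y₀ % 2 + 2 * (bit 1 y₀ + h′ Y)
    ≡⟨ regroup (y₀ % 2) (bit 1 y₀) (h′ Y) ⟩
  (y₀ % 2 + 2 * bit 1 y₀) + 2 * h′ Y
    ≡⟨ cong (_+ 2 * h′ Y) (binary-digit y₀ y₀<4) ⟩
  y₀ + 2 * h′ Y ∎
  where
  open ≡-Reasoning
  regroup : ∀ a b c → a + 2 * (b + c) ≡ (a + 2 * b) + 2 * c
  regroup = solve-∀

h′-small : ∀ y → y < 4 → h′ y ≡ y
h′-small y y<4 = trans (cong h′ (sym (+-identityʳ y))) (trans (h′-digit y 0 y<4) (+-identityʳ y))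

h′≤id : ∀ y → h′ y ≤ y
h′≤id = <-rec (λ y → h′ y ≤ y) step
  where
  step : ∀ y → (∀ {z} → z < y → h′ z ≤ z) → h′ y ≤ y
  step zero _ = z≤n
  step y@(suc _) rec = begin
    h′ y                          ≡⟨ cong h′ y≡ ⟩
    h′ (y % 4 + 4 * (y / 4))      ≡⟨ h′-digit (y % 4) (y / 4) (m%n<n y 4) ⟩
    y % 4 + 2 * h′ (y / 4)        ≤⟨ +-monoʳ-≤ (y % 4) (*-monoʳ-≤ 2 (rec (m/n<m y 4 (s≤s (s≤s z≤n))))) ⟩
    y % 4 + 2 * (y / 4)           ≤⟨ +-monoʳ-≤ (y % 4) (*-monoˡ-≤ (y / 4) {2} {4} (s≤s (s≤s z≤n))) ⟩
    y % 4 + 4 * (y / 4)           ≡⟨ y≡ ⟨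
    y                             ∎
    where
    open ≤-Reasoning
    y≡ : y ≡ y % 4 + 4 * (y / 4)
    y≡ = trans (m≡m%n+[m/n]*n y 4) (cong (y % 4 +_) (*-comm (y / 4) 4))

carry-free-digits : ∀ a₀ b₀ → a₀ < 4 → b₀ < 4 → binom₂ a₀ b₀ ≡ true → a₀ + b₀ ≤ 3
carry-free-digits 0 b₀ _ b₀<4 _ = ≤-pred b₀<4
carry-free-digits 1 0 _ _ _ = s≤s z≤n
carry-free-digits 1 2 _ _ _ = ≤-refl
carry-free-digits 2 0 _ _ _ = s≤s (s≤s z≤n)
carry-free-digits 2 1 _ _ _ = ≤-refl
carry-free-digits 3 0 _ _ _ = ≤-refl
carry-free-digits 1 1 _ _ ()
carry-free-digits 1 3 _ _ ()
carry-free-digits 2 2 _ _ ()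
carry-free-digits 2 3 _ _ ()
carry-free-digits 3 1 _ _ ()
carry-free-digits 3 2 _ _ ()
carry-free-digits 3 3 _ _ ()
carry-free-digits (suc (suc (suc (suc _)))) _ (s≤s (s≤s (s≤s (s≤s ())))) _ _
carry-free-digits (suc _) (suc (suc (suc (suc _)))) _ (s≤s (s≤s (s≤s (s≤s ())))) _

carry≤digit-sum : ∀ e a₀ b₀ → e ≤ 3 → (e + 3 * a₀ + 4 * b₀) / 4 ≤ a₀ + b₀
carry≤digit-sum e a₀ b₀ e≤3 = ≤-pred (m<n*o⇒m/o<n (begin-strict
  e + 3 * a₀ + 4 * b₀      <⟨ +-monoˡ-< (4 * b₀) (+-monoˡ-< (3 * a₀) (s≤s e≤3)) ⟩
  4 + 3 * a₀ + 4 * b₀      ≤⟨ +-monoˡ-≤ (4 * b₀) (+-monoʳ-≤ 4 (m≤n+m (3 * a₀) a₀)) ⟩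
  4 + (a₀ + 3 * a₀) + 4 * b₀ ≡⟨ regroup a₀ b₀ ⟩
  suc (a₀ + b₀) * 4        ∎))
  where
  open ≤-Reasoning
  regroup : ∀ a b → 4 + (a + 3 * a) + 4 * b ≡ suc (a + b) * 4
  regroup = solve-∀

high-digit≤carry : ∀ c a₀ b₀ → b₀ ≤ (c + a₀ + 4 * b₀) / 4
high-digit≤carry c a₀ b₀ = begin
  b₀                        ≡⟨ m*n/n≡m b₀ 4 ⟨
  b₀ * 4 / 4                ≤⟨ /-monoˡ-≤ 4 (≤-trans (≤-reflexive (*-comm b₀ 4)) (m≤n+m (4 * b₀) (c + a₀))) ⟩
  (c + a₀ + 4 * b₀) / 4     ∎
  where open ≤-Reasoning

carry-arith : ∀ c e a₀ b₀ xr yr c′ e′ Hc He →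
              xr + 4 * c′ ≡ c + a₀ + 4 * b₀ → yr + 4 * e′ ≡ e + 3 * a₀ + 4 * b₀ →
              Hc + e′ ≤ He + c′ → e′ ≤ a₀ + c′ → (xr + 2 * Hc) + e ≤ (yr + 2 * He) + c
carry-arith c e a₀ b₀ xr yr c′ e′ Hc He x≡ y≡ ih e′≤ = +-cancelʳ-≤ (4 * c′ + 4 * e′) _ _ (begin
  (xr + 2 * Hc) + e + (4 * c′ + 4 * e′)         ≡⟨ l₁ xr Hc e c′ e′ ⟩
  (xr + 4 * c′) + e + 2 * (Hc + e′) + 2 * e′    ≡⟨ cong (λ z → z + e + 2 * (Hc + e′) + 2 * e′) x≡ ⟩
  (c + a₀ + 4 * b₀) + e + 2 * (Hc + e′) + 2 * e′
    ≤⟨ +-mono-≤ (+-monoʳ-≤ (c + a₀ + 4 * b₀ + e) (*-monoʳ-≤ 2 ih)) (*-monoʳ-≤ 2 e′≤) ⟩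
  (c + a₀ + 4 * b₀) + e + 2 * (He + c′) + 2 * (a₀ + c′) ≡⟨ l₂ c a₀ b₀ e He c′ ⟩
  (e + 3 * a₀ + 4 * b₀) + 2 * He + c + 4 * c′   ≡⟨ cong (λ z → z + 2 * He + c + 4 * c′) y≡ ⟨
  (yr + 4 * e′) + 2 * He + c + 4 * c′           ≡⟨ l₃ yr e′ He c c′ ⟩
  (yr + 2 * He) + c + (4 * c′ + 4 * e′)         ∎)
  where
  open ≤-Reasoning
  l₁ : ∀ xr Hc e c′ e′ → (xr + 2 * Hc) + e + (4 * c′ + 4 * e′) ≡ (xr + 4 * c′) + e + 2 * (Hc + e′) + 2 * e′
  l₁ = solve-∀
  l₂ : ∀ c a₀ b₀ e He c′ → (c + a₀ + 4 * b₀) + e + 2 * (He + c′) + 2 * (a₀ + c′) ≡ (e + 3 * a₀ + 4 * b₀) + 2 * He + c + 4 * c′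
  l₂ = solve-∀
  l₃ : ∀ yr e′ He c c′ → (yr + 4 * e′) + 2 * He + c + 4 * c′ ≡ (yr + 2 * He) + c + (4 * c′ + 4 * e′)
  l₃ = solve-∀

base4 : ∀ n → n ≡ n % 4 + 4 * (n / 4)
base4 n = trans (m≡m%n+[m/n]*n n 4) (cong (n % 4 +_) (*-comm (n / 4) 4))

-- Compares c + A + 4B and e + 3A + 4B digit by digit in base 4, c and e being the incoming carries;
-- when A and B have no binary digit in common, the carry e stays ≤ 3.
CarryBound : ℕ → ℕ → Set
CarryBound A B = ∀ c e → e ≤ 3 → h′ (c + A + 4 * B) + e ≤ h′ (e + 3 * A + 4 * B) + c

carry-bound-zero : CarryBound 0 0
carry-bound-zero c e e≤3 = begin
  h′ (c + 0 + 0) + e   ≤⟨ +-monoˡ-≤ e (h′≤id (c + 0 + 0)) ⟩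
  c + 0 + 0 + e        ≡⟨ cong (_+ e) (trans (+-identityʳ (c + 0)) (+-identityʳ c)) ⟩
  c + e                ≡⟨ +-comm c e ⟩
  e + c                ≡⟨ cong (_+ c) (trans (cong h′ (trans (+-identityʳ (e + 0)) (+-identityʳ e))) (h′-small e (s≤s e≤3))) ⟨
  h′ (e + 0 + 0) + c   ∎
  where open ≤-Reasoning

h′-regroup : ∀ c u u₀ u′ B b₀ B′ {r q} → r < 4 → u ≡ u₀ + 4 * u′ → B ≡ b₀ + 4 * B′ →
             r + 4 * q ≡ c + u₀ + 4 * b₀ → h′ (c + u + 4 * B) ≡ r + 2 * h′ (q + u′ + 4 * B′)
h′-regroup c u u₀ u′ B b₀ B′ {r} {q} r<4 refl refl r+4q≡ = trans (cong h′ regroup) (h′-digit r (q + u′ + 4 * B′) r<4)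
  where
  regroup : c + (u₀ + 4 * u′) + 4 * (b₀ + 4 * B′) ≡ r + 4 * (q + u′ + 4 * B′)
  regroup = begin
    c + (u₀ + 4 * u′) + 4 * (b₀ + 4 * B′) ≡⟨ l₁ c u₀ u′ b₀ B′ ⟩
    (c + u₀ + 4 * b₀) + 4 * (u′ + 4 * B′) ≡⟨ cong (_+ 4 * (u′ + 4 * B′)) r+4q≡ ⟨
    (r + 4 * q) + 4 * (u′ + 4 * B′)       ≡⟨ l₂ r q u′ B′ ⟩
    r + 4 * (q + u′ + 4 * B′)             ∎
    where
    open ≡-Reasoning
    l₁ : ∀ c u₀ u′ b₀ B′ → c + (u₀ + 4 * u′) + 4 * (b₀ + 4 * B′) ≡ (c + u₀ + 4 * b₀) + 4 * (u′ + 4 * B′)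
    l₁ = solve-∀
    l₂ : ∀ r q u′ B′ → (r + 4 * q) + 4 * (u′ + 4 * B′) ≡ r + 4 * (q + u′ + 4 * B′)
    l₂ = solve-∀

carry-bound-step : ∀ A B → binom₂ A B ≡ true → (binom₂ (A / 4) (B / 4) ≡ true → CarryBound (A / 4) (B / 4)) → CarryBound A B
carry-bound-step A B binom-AB ih c e e≤3 = begin
  h′ (c + A + 4 * B) + e
    ≡⟨ cong (_+ e) (h′-regroup c A a₀ A′ B b₀ B′ {x % 4} {x / 4} (m%n<n x 4) (base4 A) (base4 B) x≡) ⟩
  (x % 4 + 2 * Hc) + e
    ≤⟨ carry-arith c e a₀ b₀ (x % 4) (y % 4) (x / 4) (y / 4) Hc He x≡ y≡ (ih (proj₂ digits) (x / 4) (y / 4) y/4≤3) y/4≤ ⟩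
  (y % 4 + 2 * He) + c
    ≡⟨ cong (_+ c) (h′-regroup e (3 * A) (3 * a₀) (3 * A′) B b₀ B′ {y % 4} {y / 4} (m%n<n y 4) 3A≡ (base4 B) y≡) ⟨
  h′ (e + 3 * A + 4 * B) + c ∎
  where
  open ≤-Reasoning
  a₀ A′ b₀ B′ x y Hc He : ℕ
  a₀ = A % 4
  A′ = A / 4
  b₀ = B % 4
  B′ = B / 4
  x = c + a₀ + 4 * b₀
  y = e + 3 * a₀ + 4 * b₀
  Hc = h′ (x / 4 + A′ + 4 * B′)
  He = h′ (y / 4 + 3 * A′ + 4 * B′)
  x≡ : x % 4 + 4 * (x / 4) ≡ c + a₀ + 4 * b₀
  x≡ = sym (base4 x)
  y≡ : y % 4 + 4 * (y / 4) ≡ e + 3 * a₀ + 4 * b₀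
  y≡ = sym (base4 y)
  3A≡ : 3 * A ≡ 3 * a₀ + 4 * (3 * A′)
  3A≡ = trans (cong (3 *_) (base4 A)) (distrib a₀ A′)
    where
    distrib : ∀ a A → 3 * (a + 4 * A) ≡ 3 * a + 4 * (3 * A)
    distrib = solve-∀
  digits : binom₂ a₀ b₀ ≡ true × binom₂ A′ B′ ≡ true
  digits = ∧-true (trans (sym (lucas₄ a₀ b₀ A′ B′ (m%n<n A 4) (m%n<n B 4)))
                         (trans (cong₂ binom₂ (sym (base4 A)) (sym (base4 B))) binom-AB))
  y/4≤ : y / 4 ≤ a₀ + x / 4
  y/4≤ = ≤-trans (carry≤digit-sum e a₀ b₀ e≤3) (+-monoʳ-≤ a₀ (high-digit≤carry c a₀ b₀))
  y/4≤3 : y / 4 ≤ 3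
  y/4≤3 = ≤-trans (carry≤digit-sum e a₀ b₀ e≤3) (carry-free-digits a₀ b₀ (m%n<n A 4) (m%n<n B 4) (proj₁ digits))

quarters< : ∀ A B → 0 < A + B → A / 4 + B / 4 < A + B
quarters< zero (suc B) _ = m/n<m (suc B) 4 (s≤s (s≤s z≤n))
quarters< (suc A) B _ = +-mono-<-≤ (m/n<m (suc A) 4 (s≤s (s≤s z≤n))) (m/n≤m B 4)

carry-bound : ∀ A B → binom₂ A B ≡ true → CarryBound A B
carry-bound A B = go A B (<-wellFounded (A + B))
  where
  go : ∀ A B → Acc _<_ (A + B) → binom₂ A B ≡ true → CarryBound A B
  go zero zero _ _ = carry-bound-zero
  go A@(suc _) B (acc rs) binom-AB = carry-bound-step A B binom-AB (go (A / 4) (B / 4) (rs (quarters< A B (s≤s z≤n))))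
  go zero B@(suc _) (acc rs) binom-AB = carry-bound-step 0 B binom-AB (go 0 (B / 4) (rs (quarters< 0 B (s≤s z≤n))))

h-gap : ∀ a b → binom₂ a b ≡ true → h (1 + a + 4 * b) + 1 ≤ h (3 + 3 * a + 4 * b)
h-gap a b odd-binom = *-cancelˡ-≤ 2 (+-cancelʳ-≤ (1 + d % 2) _ _ (begin
  2 * (h d + 1) + (1 + d % 2)     ≡⟨ l₁ (d % 2) (h d) ⟩
  h′ d + 3                        ≤⟨ carry-bound a b odd-binom 1 3 ≤-refl ⟩
  h′ k + 1                        ≡⟨ cong (λ p → p + 2 * h k + 1) same-parity ⟩
  d % 2 + 2 * h k + 1             ≡⟨ l₂ (d % 2) (h k) ⟩
  2 * h k + (1 + d % 2)           ∎))
  where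
  open ≤-Reasoning
  d k : ℕ
  d = 1 + a + 4 * b
  k = 3 + 3 * a + 4 * b
  same-parity : k % 2 ≡ d % 2
  same-parity = trans (cong (_% 2) (l₃ a b)) ([m+kn]%n≡m%n d (1 + a) 2)
    where
    l₃ : ∀ a b → 3 + 3 * a + 4 * b ≡ (1 + a + 4 * b) + (1 + a) * 2
    l₃ = solve-∀
  l₁ : ∀ p x → 2 * (x + 1) + (1 + p) ≡ (p + 2 * x) + 3
  l₁ = solve-∀
  l₂ : ∀ p y → p + 2 * y + 1 ≡ 2 * y + (1 + p)
  l₂ = solve-∀

proposition4p12 : (k : ℕ) (P : Poly) →
    (∀ n → evalAtΔ P n ≡ T₃ (powS Δ k) n) →
    ∀ d → coeff P d ≡ true → h d + 1 ≤ h k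
proposition4p12 k P P≡T₃Δᵏ d Pd = gap (P[]-support k d P[k]d)
  where
  P[k]d : coeff P[ k ] d ≡ true
  P[k]d = trans (sym (evalAtΔ-injective P P[ k ] (λ n → trans (P≡T₃Δᵏ n) (sym (evalAtΔ-P[] k n))) d)) Pd
  gap : ∃[ a ] ∃[ b ] (k ≡ 3 + 3 * a + 4 * b × d ≡ 1 + a + 4 * b × binom₂ a b ≡ true) → h d + 1 ≤ h k
  gap (a , b , k≡ , d≡ , odd-binom) = subst₂ (λ d k → h d + 1 ≤ h k) (sym d≡) (sym k≡) (h-gap a b odd-binom)
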